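{- Consider black-peg Mastermind with $n$ positions and $k=\Theta(n)$ colors. The random guessing strategy (querying strings chosen independently and uniformly at random from $[k]^n$) needs an expected number of $O(n\log n)$ queries to determine any fixed secret code $z\in[k]^n$. Furthermore, for a large enough constant $C$, with probability $1-o(1)$ the first $Cn\log n$ queries determine $z$.
   Context: In black-peg Mastermind a guess $x\in[k]^n$ is answered by $\mathrm{eq}(z,x)=|\{i: z_i=x_i\}|$, where $z$ is the secret code. The queries asked so far determine $z$ if $z$ is the only code in $[k]^n$ consistent with their answers. Asymptotics are as $n\to\infty$. -}

module Defs where

open import Data.Nat using (ℕ; zero; suc; _+_; _*_; _^_; _≡ᵇ_)
open import Data.Nat.Logarithm using (⌊log₂_⌋)
open import Data.Fin using (Fin) renaming (_≟_ to _≟ᶠ_)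
open import Data.Bool using (Bool; true; false; not; _∨_; if_then_else_)
open import Data.List using (List; []; _∷_; map; concatMap; allFin; length; foldr; filterᵇ)
open import Data.Vec using (Vec; []; _∷_)
open import Data.Vec.Properties using (≡-dec)
open import Data.Integer using (+_)
open import Data.Rational using (ℚ; 0ℚ; _/_) renaming (_+_ to _+ℚ_)
open import Relation.Nullary.Decidable using (⌊_⌋)

Code : ℕ → ℕ → Set
Code k n = Vec (Fin k) n

eq : ∀ {k n} → Code k n → Code k n → ℕ
eq []       []       = 0
eq (a ∷ z)  (b ∷ x)  = (if ⌊ a ≟ᶠ b ⌋ then 1 else 0) + eq z x

allVecs : ∀ {A : Set} → List A → (m : ℕ) → List (Vec A m)
allVecs xs zero    = [] ∷ []
allVecs xs (suc m) = concatMap (λ x → map (x ∷_) (allVecs xs m)) xs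

allCodes : (k n : ℕ) → List (Code k n)
allCodes k n = allVecs (allFin k) n

consistentᵇ : ∀ {k n m} → Vec (Code k n) m → Code k n → Code k n → Bool
consistentᵇ []       z y = true
consistentᵇ (q ∷ qs) z y = (eq y q ≡ᵇ eq z q) Data.Bool.∧ consistentᵇ qs z y

determinesᵇ : ∀ {k n m} → Vec (Code k n) m → Code k n → Bool
determinesᵇ {k} {n} qs z =
  foldr (λ y b → (not (consistentᵇ qs z y) ∨ ⌊ ≡-dec _≟ᶠ_ y z ⌋) Data.Bool.∧ b) true (allCodes k n)

failures : (k n m : ℕ) → Code k n → ℕ
failures k n m z =
  length (filterᵇ (λ qs → not (determinesᵇ qs z)) (allVecs (allCodes k n) m))

-- a / d as a rational (d = 0 gives 0; never used with d = 0 in the statement).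
frac : ℕ → ℕ → ℚ
frac a zero    = 0ℚ
frac a (suc d) = (+ a) / suc d

-- Pr[ the first m uniformly random queries do not determine z ] = failures / k^(n m).
probFail : (k n m : ℕ) → Code k n → ℚ
probFail k n m z = frac (failures k n m z) (k ^ (n * m))

-- Partial sum  Σ_{m < M} Pr[T > m]  where T = number of queries until z is determined.
-- E[T] = Σ_{m ≥ 0} Pr[T > m], so E[T] ≤ B iff every such partial sum is ≤ B.
expPartial : (k n M : ℕ) → Code k n → ℚ
expPartial k n zero    z = 0ℚ
expPartial k n (suc M) z = expPartial k n M z +ℚ probFail k n M z

ℕtoℚ : ℕ → ℚ
ℕtoℚ a = (+ a) / 1

-- C · n · log n  (log taken base 2, rounded down; base only affects the constant)
nlogn : ℕ → ℕ → ℕ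
nlogn C n = C * n * ⌊log₂ n ⌋

module Submission where

-- A code y ≠ z survives m independent uniform queries with probability p^m, where p = Pr[eq(y,x) = eq(z,x)]
-- is at most 1 − min(d, q)/k for the Hamming distance d of y and z and q = ⌊k/3⌋ (induction on n, carrying
-- an offset between the two answers). So p^m ≤ (1 − 1/k)^(d m) + (1 − q/k)^m, and the union bound over y gives
-- failure probability at most 2 n k (1 − 1/k)^m + k^n (1 − q/k)^m. Both terms drop below 1/2 after
-- M = O(n log n) queries, and from then on every k queries halve them. Hence the expected number of queries
-- is at most M plus a geometric tail, and C n log n queries fail with probability o(1). Probabilities are
-- handled as counts over [k]^n with denominators cleared.

open import Algebra.Properties.CommutativeSemigroup using (interchange; x∙yz≈y∙xz; xy∙z≈xz∙y)
import Data.Integer as ℤ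
import Data.Integer.Properties as ℤ
open import Data.Bool using (Bool; true; false; not; _∧_; _∨_; if_then_else_)
open import Data.Empty using (⊥-elim)
open import Data.Fin using (Fin; zero; suc) renaming (_≟_ to _≟ᶠ_)
open import Data.List using (List; []; _∷_; _++_; map; concat; concatMap; allFin; foldr; filterᵇ; length)
open import Data.List.Properties using (map-tabulate; length-tabulate)
open import Data.Nat
  using (ℕ; zero; suc; _+_; _*_; _^_; _∸_; _/_; _%_; _≤_; _<_; _⊓_; _≡ᵇ_; _≤?_; z≤n; s≤s; s≤s⁻¹; ⌊_/2⌋; NonZero; >-nonZero)
open import Data.Nat.DivMod using (m/n*n≤m; m≥n⇒m/n>0; m≡m%n+[m/n]*n; m%n<n)
open import Data.Nat.Induction using (<-wellFounded)
open import Data.Nat.Logarithm using (⌊log₂_⌋; ⌊log₂⌋-mono-≤; ⌊log₂[2^n]⌋≡n)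
open import Data.Nat.Logarithm.Core using (⌊log2⌋)
open import Data.Nat.Properties
open import Data.Nat.Tactic.RingSolver using (solve; solve-∀)
open import Data.Product using (Σ; _×_; _,_)
open import Data.Rational using (ℚ; 0ℚ; 1ℚ; mkℚ; positive; toℚᵘ) renaming (_≤_ to _≤ℚ_; _<_ to _<ℚ_; _+_ to _+ℚ_)
import Data.Rational.Properties as ℚ
open import Data.Rational.Unnormalised using (mkℚᵘ; *≤*; _≃_) renaming (_+_ to _+ᵘ_)
import Data.Rational.Unnormalised.Properties as ℚᵘ
open import Induction.WellFounded using (Acc; acc)
open import Relation.Binary.PropositionalEquality
open import Relation.Nullary using (¬_; Dec; contradiction)
open import Relation.Nullary.Decidable using (⌊_⌋; yes; no)

open import Defs

^-distribʳ-* : ∀ a b n → (a * b) ^ n ≡ a ^ n * b ^ n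
^-distribʳ-* a b zero    = refl
^-distribʳ-* a b (suc n) = trans (cong (a * b *_) (^-distribʳ-* a b n))
                                 (interchange *-commutativeSemigroup a b (a ^ n) (b ^ n))

1≤m^n : ∀ m n → 1 ≤ m → 1 ≤ m ^ n
1≤m^n m n 1≤m = m^n>0 m {{>-nonZero 1≤m}} n

m<2^m : ∀ m → m < 2 ^ m
m<2^m zero    = s≤s z≤n
m<2^m (suc m) = begin-strict
  suc m        <⟨ s≤s (m<2^m m) ⟩
  suc (2 ^ m)  ≤⟨ +-monoˡ-≤ (2 ^ m) (m^n>0 2 m) ⟩
  2 ^ m + 2 ^ m ≡⟨ cong (2 ^ m +_) (+-identityʳ (2 ^ m)) ⟨
  2 ^ suc m    ∎
  where open ≤-Reasoning

m*[m∸[n+o]]≤[m∸o]*[m∸n] : ∀ m n o → m * (m ∸ (n + o)) ≤ (m ∸ o) * (m ∸ n)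
m*[m∸[n+o]]≤[m∸o]*[m∸n] m n o with n + o ≤? m
... | no  n+o≰m rewrite m≤n⇒m∸n≡0 (<⇒≤ (≰⇒> n+o≰m)) | *-zeroʳ m = z≤n
... | yes n+o≤m with r , refl ← m≤n⇒∃[o]m+o≡n n+o≤m = begin
  (n + o + r) * (n + o + r ∸ (n + o))   ≡⟨ cong ((n + o + r) *_) (m+n∸m≡n (n + o) r) ⟩
  (n + o + r) * r                        ≤⟨ m≤m+n _ (n * o) ⟩
  (n + o + r) * r + n * o                ≡⟨ solve (n ∷ o ∷ r ∷ []) ⟩
  (n + r) * (o + r)                      ≡⟨ cong₂ _*_ (m+n∸m≡n o (n + r)) (m+n∸m≡n n (o + r)) ⟨
  (o + (n + r) ∸ o) * (n + (o + r) ∸ n)  ≡⟨ cong₂ (λ x y → (x ∸ o) * (y ∸ n)) (solve (n ∷ o ∷ r ∷ [])) (+-assoc n o r) ⟨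
  (n + o + r ∸ o) * (n + o + r ∸ n)      ∎
  where open ≤-Reasoning

bernoulli-∸ : ∀ b c n → b ^ n * (b ∸ n * c) ≤ b * (b ∸ c) ^ n
bernoulli-∸ b c zero    = ≤-reflexive (*-comm 1 b)
bernoulli-∸ b c (suc n) = begin
  b ^ suc n * (b ∸ (c + n * c))      ≡⟨ *-assoc b (b ^ n) _ ⟩
  b * (b ^ n * (b ∸ (c + n * c)))    ≡⟨ x∙yz≈y∙xz *-commutativeSemigroup b (b ^ n) _ ⟩
  b ^ n * (b * (b ∸ (c + n * c)))    ≤⟨ *-monoʳ-≤ (b ^ n) (m*[m∸[n+o]]≤[m∸o]*[m∸n] b c (n * c)) ⟩
  b ^ n * ((b ∸ n * c) * (b ∸ c))    ≡⟨ *-assoc (b ^ n) _ _ ⟨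
  b ^ n * (b ∸ n * c) * (b ∸ c)      ≤⟨ *-monoˡ-≤ (b ∸ c) (bernoulli-∸ b c n) ⟩
  b * (b ∸ c) ^ n * (b ∸ c)          ≡⟨ trans (*-assoc b _ _) (cong (b *_) (*-comm _ (b ∸ c))) ⟩
  b * (b ∸ c) ^ suc n                ∎
  where open ≤-Reasoning

bernoulli-+ : ∀ a b t → a ^ t * (a + t * b) ≤ a * (a + b) ^ t
bernoulli-+ a b zero    = ≤-reflexive (solve (a ∷ b ∷ []))
bernoulli-+ a b (suc t) = begin
  a ^ suc t * (a + suc t * b)                   ≡⟨ *-assoc a (a ^ t) _ ⟩
  a * (a ^ t * (a + suc t * b))                 ≡⟨ x∙yz≈y∙xz *-commutativeSemigroup a (a ^ t) _ ⟩
  a ^ t * (a * (a + suc t * b))                 ≤⟨ *-monoʳ-≤ (a ^ t) (m≤m+n _ (t * b * b)) ⟩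
  a ^ t * (a * (a + suc t * b) + t * b * b)     ≡⟨ cong (a ^ t *_) (solve (a ∷ b ∷ t ∷ [])) ⟩
  a ^ t * ((a + t * b) * (a + b))               ≡⟨ *-assoc (a ^ t) _ _ ⟨
  a ^ t * (a + t * b) * (a + b)              ≤⟨ *-monoˡ-≤ (a + b) (bernoulli-+ a b t) ⟩
  a * (a + b) ^ t * (a + b)                  ≡⟨ trans (*-assoc a _ _) (cong (a *_) (*-comm _ (a + b))) ⟩
  a * (a + b) ^ suc t                        ∎
  where open ≤-Reasoning

[m+n]*[m∸n]≤m*m : ∀ m n → (m + n) * (m ∸ n) ≤ m * m
[m+n]*[m∸n]≤m*m m n with n ≤? m
... | no  n≰m rewrite m≤n⇒m∸n≡0 (<⇒≤ (≰⇒> n≰m)) | *-zeroʳ (m + n) = z≤n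
... | yes n≤m with s , refl ← m≤n⇒∃[o]m+o≡n n≤m = begin
  (n + s + n) * (n + s ∸ n)  ≡⟨ cong ((n + s + n) *_) (m+n∸m≡n n s) ⟩
  (n + s + n) * s            ≤⟨ m≤m+n _ (n * n) ⟩
  (n + s + n) * s + n * n    ≡⟨ solve (n ∷ s ∷ []) ⟩
  (n + s) * (n + s)          ∎
  where open ≤-Reasoning

[m+n]^k≤2*m^k : ∀ m n k → 1 ≤ m → 2 * (k * n) ≤ m → (m + n) ^ k ≤ 2 * m ^ k
[m+n]^k≤2*m^k m n k 1≤m 2kn≤m = *-cancelʳ-≤ _ _ (m ^ k * m) {{m^k*m≢0}} (begin
  (m + n) ^ k * (m ^ k * m)                  ≤⟨ *-monoʳ-≤ ((m + n) ^ k) (*-monoʳ-≤ (m ^ k) m≤2[m∸kn]) ⟩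
  (m + n) ^ k * (m ^ k * (2 * (m ∸ k * n)))  ≡⟨ pull-2 ((m + n) ^ k) (m ^ k) (m ∸ k * n) ⟩
  2 * ((m + n) ^ k * (m ^ k * (m ∸ k * n)))  ≤⟨ *-monoʳ-≤ 2 (*-monoʳ-≤ ((m + n) ^ k) (bernoulli-∸ m n k)) ⟩
  2 * ((m + n) ^ k * (m * (m ∸ n) ^ k))      ≡⟨ cong (2 *_) (x∙yz≈y∙xz *-commutativeSemigroup ((m + n) ^ k) m ((m ∸ n) ^ k)) ⟩
  2 * (m * ((m + n) ^ k * (m ∸ n) ^ k))      ≡⟨ cong (λ x → 2 * (m * x)) (^-distribʳ-* (m + n) (m ∸ n) k) ⟨
  2 * (m * ((m + n) * (m ∸ n)) ^ k)          ≤⟨ *-monoʳ-≤ 2 (*-monoʳ-≤ m (^-monoˡ-≤ k ([m+n]*[m∸n]≤m*m m n))) ⟩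
  2 * (m * (m * m) ^ k)                      ≡⟨ cong (λ x → 2 * (m * x)) (^-distribʳ-* m m k) ⟩
  2 * (m * (m ^ k * m ^ k))                  ≡⟨ regroup m (m ^ k) ⟩
  2 * m ^ k * (m ^ k * m)                    ∎)
  where
  open ≤-Reasoning
  m^k*m≢0 : NonZero (m ^ k * m)
  m^k*m≢0 = >-nonZero (*-mono-≤ (m^n>0 m {{>-nonZero 1≤m}} k) 1≤m)
  m≤2[m∸kn] : m ≤ 2 * (m ∸ k * n)
  m≤2[m∸kn] = ≤-trans (m+n≤o⇒m≤o∸n m (+-monoʳ-≤ m 2kn≤m))
                      (≤-reflexive (trans (cong (λ x → m + x ∸ 2 * (k * n)) (sym (+-identityʳ m))) (sym (*-distribˡ-∸ 2 m (k * n)))))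
  pull-2 : ∀ x y z → x * (y * (2 * z)) ≡ 2 * (x * (y * z))
  pull-2 = solve-∀
  regroup : ∀ x y → 2 * (x * (y * y)) ≡ 2 * y * (y * x)
  regroup = solve-∀

^-doubling : ∀ a b t → 1 ≤ a → a ≤ t * b → a ^ t * 2 ≤ (a + b) ^ t
^-doubling a b t 1≤a a≤tb = *-cancelˡ-≤ a {{>-nonZero 1≤a}} (begin
  a * (a ^ t * 2)      ≡⟨ x∙yz≈y∙xz *-commutativeSemigroup a (a ^ t) 2 ⟩
  a ^ t * (a * 2)      ≤⟨ *-monoʳ-≤ (a ^ t) (≤-trans (≤-reflexive (trans (*-comm a 2) (cong (a +_) (+-identityʳ a)))) (+-monoʳ-≤ a a≤tb)) ⟩
  a ^ t * (a + t * b)  ≤⟨ bernoulli-+ a b t ⟩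
  a * (a + b) ^ t      ∎)
  where open ≤-Reasoning

[k∸1]^k*2≤k^k : ∀ k → 2 ≤ k → (k ∸ 1) ^ k * 2 ≤ k ^ k
[k∸1]^k*2≤k^k (suc a) (s≤s 1≤a) =
  subst (λ x → a ^ suc a * 2 ≤ x ^ suc a) (+-comm a 1)
        (^-doubling a 1 (suc a) 1≤a (≤-trans (n≤1+n a) (≤-reflexive (sym (*-identityʳ (suc a))))))

[k∸q]^6*2≤k^6 : ∀ k q → q < k → k ≤ 7 * q → (k ∸ q) ^ 6 * 2 ≤ k ^ 6
[k∸q]^6*2≤k^6 k q q<k k≤7q =
  subst (λ x → (k ∸ q) ^ 6 * 2 ≤ x ^ 6) (m∸n+n≡m (<⇒≤ q<k))
        (^-doubling (k ∸ q) q 6 (m<n⇒0<n∸m q<k) (≤-trans (∸-monoˡ-≤ q k≤7q) (≤-reflexive (m+n∸m≡n q (6 * q)))))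

^-halving : ∀ {a b s} → a ^ s * 2 ≤ b ^ s → a ≤ b → ∀ t m → t * s ≤ m → a ^ m * 2 ^ t ≤ b ^ m
^-halving {a} {b} {s} halves a≤b zero m _ = begin
  a ^ m * 1  ≡⟨ *-identityʳ _ ⟩
  a ^ m      ≤⟨ ^-monoˡ-≤ m a≤b ⟩
  b ^ m      ∎
  where open ≤-Reasoning
^-halving {a} {b} {s} halves a≤b (suc t) m [1+t]s≤m with r , refl ← m≤n⇒∃[o]m+o≡n [1+t]s≤m = begin
  a ^ (s + t * s + r) * (2 * 2 ^ t)      ≡⟨ cong (λ e → a ^ e * (2 * 2 ^ t)) (+-assoc s (t * s) r) ⟩
  a ^ (s + (t * s + r)) * (2 * 2 ^ t)    ≡⟨ cong (_* (2 * 2 ^ t)) (^-distribˡ-+-* a s (t * s + r)) ⟩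
  a ^ s * a ^ (t * s + r) * (2 * 2 ^ t)  ≡⟨ interchange *-commutativeSemigroup (a ^ s) (a ^ (t * s + r)) 2 (2 ^ t) ⟩
  a ^ s * 2 * (a ^ (t * s + r) * 2 ^ t)  ≤⟨ *-mono-≤ halves (^-halving halves a≤b t (t * s + r) (m≤m+n _ r)) ⟩
  b ^ s * b ^ (t * s + r)                ≡⟨ ^-distribˡ-+-* b s (t * s + r) ⟨
  b ^ (s + (t * s + r))                  ≡⟨ cong (b ^_) (+-assoc s (t * s) r) ⟨
  b ^ (s + t * s + r)                    ∎
  where open ≤-Reasoning

*-^-halving : ∀ {a b s c t} M → a ^ s * 2 ≤ b ^ s → a ≤ b → c ≤ 2 ^ t → t * s ≤ M → c * a ^ M ≤ b ^ M
*-^-halving {a} {b} {c = c} {t} M halves a≤b c≤2^t ts≤M =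
  ≤-trans (*-monoˡ-≤ (a ^ M) c≤2^t) (≤-trans (≤-reflexive (*-comm (2 ^ t) (a ^ M))) (^-halving halves a≤b t M ts≤M))

3*[k/3]≤k : ∀ k → 3 * (k / 3) ≤ k
3*[k/3]≤k k = subst (_≤ k) (*-comm (k / 3) 3) (m/n*n≤m k 3)

1≤k/3 : ∀ {k} → 3 ≤ k → 1 ≤ k / 3
1≤k/3 3≤k = m≥n⇒m/n>0 3≤k

k≤7*[k/3] : ∀ {k} → 3 ≤ k → k ≤ 7 * (k / 3)
k≤7*[k/3] {k} 3≤k = begin
  k                      ≡⟨ m≡m%n+[m/n]*n k 3 ⟩
  k % 3 + k / 3 * 3      ≤⟨ +-monoˡ-≤ (k / 3 * 3) (≤-trans (s≤s⁻¹ (m%n<n k 3)) (≤-trans (s≤s (s≤s z≤n)) (*-monoʳ-≤ 4 (1≤k/3 3≤k)))) ⟩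
  4 * (k / 3) + k / 3 * 3 ≡⟨ cong (4 * (k / 3) +_) (*-comm (k / 3) 3) ⟩
  4 * (k / 3) + 3 * (k / 3) ≡⟨ *-distribʳ-+ (k / 3) 4 3 ⟨
  7 * (k / 3)            ∎
  where open ≤-Reasoning

3q≤k⇒q<k : ∀ {q k} → 1 ≤ q → 3 * q ≤ k → q < k
3q≤k⇒q<k {q} 1≤q 3q≤k = <-≤-trans (m<m+n q (≤-trans 1≤q (m≤m+n q _))) 3q≤k

-- In the next two lemmas S counts the agreements of two codes extended by different symbols, a, b, X
-- those of the shorter codes with answer offsets (1, 0), (0, 1), (0, 0), and P = k^n: a differing position
-- lowers the agreement probability by 1/k while 3 j < k, and keeps it below 1 − q/k afterwards.
agreement-step-near : ∀ {k j P S a b X} → 3 * suc j ≤ k →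
  S + (X + X) ≡ a + b + k * X → a + b + X ≤ P → k * X + P * j ≤ P * k →
  k * S + k * P * suc j ≤ k * P * k
agreement-step-near {k} {j} {P} {S} {a} {b} {X} 3[j+1]≤k split disjoint bound
  with r , refl ← m≤n⇒∃[o]m+o≡n 3[j+1]≤k =
  let t = 3 * j + r in
  +-cancelʳ-≤ (t * (P * j)) _ _ (begin
    k * S + k * P * suc j + t * (P * j)                 ≡⟨ solve (j ∷ r ∷ P ∷ S ∷ []) ⟩
    (k * S + t * (P * j)) + k * P * suc j               ≤⟨ +-monoˡ-≤ (k * P * suc j) (begin
      k * S + t * (P * j)                               ≤⟨ +-monoˡ-≤ (t * (P * j)) (*-monoʳ-≤ k S≤P+tX) ⟩
      k * (P + t * X) + t * (P * j)                     ≡⟨ solve (j ∷ r ∷ P ∷ X ∷ []) ⟩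
      k * P + t * (k * X + P * j)                       ≤⟨ +-monoʳ-≤ (k * P) (*-monoʳ-≤ t bound) ⟩
      k * P + t * (P * k)                               ∎) ⟩
    k * P + t * (P * k) + k * P * suc j                 ≤⟨ m≤m+n _ (P * (3 + r)) ⟩
    k * P + t * (P * k) + k * P * suc j + P * (3 + r)   ≡⟨ solve (j ∷ r ∷ P ∷ []) ⟩
    k * P * k + t * (P * j)                             ∎)
  where
  open ≤-Reasoning
  S≤P+tX : S ≤ P + (3 * j + r) * X
  S≤P+tX = +-cancelʳ-≤ (3 * X) _ _ (begin
    S + 3 * X                        ≡⟨ solve (S ∷ X ∷ []) ⟩
    S + (X + X) + X                  ≡⟨ cong (_+ X) split ⟩
    a + b + k * X + X                ≡⟨ solve (a ∷ b ∷ X ∷ j ∷ r ∷ []) ⟩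
    a + b + X + k * X                ≤⟨ +-monoˡ-≤ (k * X) disjoint ⟩
    P + k * X                        ≡⟨ solve (P ∷ X ∷ j ∷ r ∷ []) ⟩
    P + (3 * j + r) * X + 3 * X      ∎)

agreement-step-far : ∀ {k q P S a b X} → 2 ≤ k →
  S + (X + X) ≡ a + b + k * X →
  k * a + P * q ≤ P * k → k * b + P * q ≤ P * k → k * X + P * q ≤ P * k →
  k * S + k * P * q ≤ k * P * k
agreement-step-far {k} {q} {P} {S} {a} {b} {X} 2≤k split bound-a bound-b bound-X
  with t , refl ← m≤n⇒∃[o]m+o≡n 2≤k =
  +-cancelʳ-≤ (2 * (k * X)) _ _ (begin
    k * S + k * P * q + 2 * (k * X)                  ≡⟨ solve (t ∷ S ∷ P ∷ q ∷ X ∷ []) ⟩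
    k * (S + (X + X)) + k * P * q                    ≡⟨ cong (λ s → k * s + k * P * q) split ⟩
    k * (a + b + k * X) + k * P * q                  ≡⟨ solve (t ∷ a ∷ b ∷ X ∷ P ∷ q ∷ []) ⟩
    (k * a + P * q) + (k * b + P * q) + 2 * (k * X) + t * (k * X + P * q)
      ≤⟨ +-mono-≤ (+-monoˡ-≤ (2 * (k * X)) (+-mono-≤ bound-a bound-b)) (*-monoʳ-≤ t bound-X) ⟩
    P * k + P * k + 2 * (k * X) + t * (P * k)        ≡⟨ solve (t ∷ P ∷ X ∷ []) ⟩
    k * P * k + 2 * (k * X)                          ∎)
  where open ≤-Reasoning

𝟙 : Bool → ℕ
𝟙 b = if b then 1 else 0

𝟙≤1 : ∀ b → 𝟙 b ≤ 1
𝟙≤1 true  = ≤-refl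
𝟙≤1 false = z≤n

𝟙-∧ : ∀ a b → 𝟙 (a ∧ b) ≡ 𝟙 a * 𝟙 b
𝟙-∧ true  b = sym (+-identityʳ (𝟙 b))
𝟙-∧ false b = refl

∑ : {A : Set} → List A → (A → ℕ) → ℕ
∑ []       f = 0
∑ (x ∷ xs) f = f x + ∑ xs f

infix 5 ∑
syntax ∑ xs (λ x → e) = ∑[ x ∈ xs ] e

module _ {A : Set} where

  ∑-cong : ∀ (xs : List A) {f g : A → ℕ} → (∀ x → f x ≡ g x) → ∑ xs f ≡ ∑ xs g
  ∑-cong []       f≗g = refl
  ∑-cong (x ∷ xs) f≗g = cong₂ _+_ (f≗g x) (∑-cong xs f≗g)

  ∑-mono-≤ : ∀ (xs : List A) {f g : A → ℕ} → (∀ x → f x ≤ g x) → ∑ xs f ≤ ∑ xs g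
  ∑-mono-≤ []       f≤g = z≤n
  ∑-mono-≤ (x ∷ xs) f≤g = +-mono-≤ (f≤g x) (∑-mono-≤ xs f≤g)

  ∑-distrib-+ : ∀ (xs : List A) (f g : A → ℕ) → ∑[ x ∈ xs ] (f x + g x) ≡ ∑ xs f + ∑ xs g
  ∑-distrib-+ []       f g = refl
  ∑-distrib-+ (x ∷ xs) f g = trans (cong (f x + g x +_) (∑-distrib-+ xs f g))
                                  (interchange +-commutativeSemigroup (f x) (g x) (∑ xs f) (∑ xs g))

  ∑-*ˡ : ∀ (xs : List A) c (f : A → ℕ) → ∑[ x ∈ xs ] (c * f x) ≡ c * ∑ xs f
  ∑-*ˡ []       c f = sym (*-zeroʳ c)
  ∑-*ˡ (x ∷ xs) c f = trans (cong (c * f x +_) (∑-*ˡ xs c f)) (sym (*-distribˡ-+ c (f x) (∑ xs f)))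

  ∑-*ʳ : ∀ (xs : List A) c (f : A → ℕ) → ∑[ x ∈ xs ] (f x * c) ≡ ∑ xs f * c
  ∑-*ʳ xs c f = trans (∑-cong xs (λ x → *-comm (f x) c)) (trans (∑-*ˡ xs c f) (*-comm c (∑ xs f)))

  ∑-const : ∀ (xs : List A) c → ∑[ _ ∈ xs ] c ≡ length xs * c
  ∑-const []       c = refl
  ∑-const (x ∷ xs) c = cong (c +_) (∑-const xs c)

  ∑-++ : ∀ (xs ys : List A) (f : A → ℕ) → ∑ (xs ++ ys) f ≡ ∑ xs f + ∑ ys f
  ∑-++ []       ys f = refl
  ∑-++ (x ∷ xs) ys f = trans (cong (f x +_) (∑-++ xs ys f)) (sym (+-assoc (f x) _ _))

  length-filterᵇ : ∀ (p : A → Bool) xs → length (filterᵇ p xs) ≡ ∑[ x ∈ xs ] 𝟙 (p x)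
  length-filterᵇ p []       = refl
  length-filterᵇ p (x ∷ xs) with p x
  ... | true  = cong suc (length-filterᵇ p xs)
  ... | false = length-filterᵇ p xs

  𝟙-not-all-≤ : ∀ (p : A → Bool) xs → 𝟙 (not (foldr (λ x b → p x ∧ b) true xs)) ≤ ∑[ x ∈ xs ] 𝟙 (not (p x))
  𝟙-not-all-≤ p []       = z≤n
  𝟙-not-all-≤ p (x ∷ xs) with p x
  ... | true  = 𝟙-not-all-≤ p xs
  ... | false = s≤s z≤n

module _ {A B : Set} where

  ∑-map : ∀ (h : A → B) xs (f : B → ℕ) → ∑ (map h xs) f ≡ ∑[ x ∈ xs ] f (h x)
  ∑-map h []       f = refl
  ∑-map h (x ∷ xs) f = cong (f (h x) +_) (∑-map h xs f)

  ∑-concatMap : ∀ (g : A → List B) xs (f : B → ℕ) → ∑ (concatMap g xs) f ≡ ∑[ x ∈ xs ] ∑ (g x) f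
  ∑-concatMap g []       f = refl
  ∑-concatMap g (x ∷ xs) f = trans (∑-++ (g x) (concat (map g xs)) f) (cong (∑ (g x) f +_) (∑-concatMap g xs f))

  ∑-comm : ∀ xs ys (f : A → B → ℕ) → ∑[ x ∈ xs ] ∑[ y ∈ ys ] f x y ≡ ∑[ y ∈ ys ] ∑[ x ∈ xs ] f x y
  ∑-comm []       ys f = sym (trans (∑-const ys 0) (*-zeroʳ (length ys)))
  ∑-comm (x ∷ xs) ys f = trans (cong (∑ ys (f x) +_) (∑-comm xs ys f))
                              (sym (∑-distrib-+ ys (f x) (λ y → ∑[ x′ ∈ xs ] f x′ y)))

δ : ∀ {k} → Fin k → Fin k → ℕ
δ a x = 𝟙 ⌊ a ≟ᶠ x ⌋

δ-suc : ∀ {k} (a x : Fin k) → δ (suc a) (suc x) ≡ δ a x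
δ-suc a x with a ≟ᶠ x
... | yes _ = refl
... | no  _ = refl

δ-sym : ∀ {k} (a x : Fin k) → δ a x ≡ δ x a
δ-sym a x with a ≟ᶠ x | x ≟ᶠ a
... | yes _   | yes _   = refl
... | no  _   | no  _   = refl
... | yes a≡x | no  x≢a = ⊥-elim (x≢a (sym a≡x))
... | no  a≢x | yes x≡a = ⊥-elim (a≢x (sym x≡a))

∑-allFin-suc : ∀ k (f : Fin (suc k) → ℕ) → ∑ (allFin (suc k)) f ≡ f zero + (∑[ x ∈ allFin k ] f (suc x))
∑-allFin-suc k f = cong (f zero +_) (trans (cong (λ xs → ∑ xs f) (sym (map-tabulate (λ x → x) suc)))
                                            (∑-map suc (allFin k) f))

∑-allFin-const : ∀ k c → ∑[ _ ∈ allFin k ] c ≡ k * c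
∑-allFin-const k c = trans (∑-const (allFin k) c) (cong (_* c) (length-tabulate {n = k} (λ x → x)))

-- Both point sums are stated with the excluded terms moved to the left, avoiding subtraction.
∑-allFin-δ : ∀ {k} (a : Fin k) (h : ℕ → ℕ) → (∑[ x ∈ allFin k ] h (δ a x)) + h 0 ≡ h 1 + k * h 0
∑-allFin-δ {suc k} zero h = begin
  (∑[ x ∈ allFin (suc k) ] h (δ zero x)) + h 0  ≡⟨ cong (_+ h 0) (∑-allFin-suc k (λ x → h (δ zero x))) ⟩
  h 1 + (∑[ x ∈ allFin k ] h 0) + h 0         ≡⟨ cong (λ s → h 1 + s + h 0) (∑-allFin-const k (h 0)) ⟩
  h 1 + k * h 0 + h 0                         ≡⟨ +-assoc (h 1) _ (h 0) ⟩
  h 1 + (k * h 0 + h 0)                       ≡⟨ cong (h 1 +_) (+-comm (k * h 0) (h 0)) ⟩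
  h 1 + suc k * h 0                           ∎
  where open ≡-Reasoning
∑-allFin-δ {suc k} (suc a) h = begin
  (∑[ x ∈ allFin (suc k) ] h (δ (suc a) x)) + h 0 ≡⟨ cong (_+ h 0) (∑-allFin-suc k (λ x → h (δ (suc a) x))) ⟩
  h 0 + (∑[ x ∈ allFin k ] h (δ (suc a) (suc x))) + h 0
    ≡⟨ cong (λ s → h 0 + s + h 0) (∑-cong (allFin k) (λ x → cong h (δ-suc a x))) ⟩
  h 0 + (∑[ x ∈ allFin k ] h (δ a x)) + h 0      ≡⟨ +-assoc (h 0) _ (h 0) ⟩
  h 0 + ((∑[ x ∈ allFin k ] h (δ a x)) + h 0)  ≡⟨ cong (h 0 +_) (∑-allFin-δ a h) ⟩
  h 0 + (h 1 + k * h 0)                          ≡⟨ +-comm (h 0) _ ⟩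
  h 1 + k * h 0 + h 0                            ≡⟨ +-assoc (h 1) _ (h 0) ⟩
  h 1 + (k * h 0 + h 0)                          ≡⟨ cong (h 1 +_) (+-comm (k * h 0) (h 0)) ⟩
  h 1 + suc k * h 0                              ∎
  where open ≡-Reasoning

∑-allFin-δ₂ : ∀ {k} {a b : Fin k} → ¬ a ≡ b → (h : ℕ → ℕ → ℕ) →
  (∑[ x ∈ allFin k ] h (δ a x) (δ b x)) + (h 0 0 + h 0 0) ≡ h 1 0 + h 0 1 + k * h 0 0
∑-allFin-δ₂ {suc k} {zero}  {zero}  a≢b h = ⊥-elim (a≢b refl)
∑-allFin-δ₂ {suc k} {zero}  {suc b} a≢b h = begin
  (∑[ x ∈ allFin (suc k) ] h (δ zero x) (δ (suc b) x)) + (h 0 0 + h 0 0)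
    ≡⟨ cong (_+ (h 0 0 + h 0 0)) (∑-allFin-suc k (λ x → h (δ zero x) (δ (suc b) x))) ⟩
  h 1 0 + (∑[ x ∈ allFin k ] h 0 (δ (suc b) (suc x))) + (h 0 0 + h 0 0)
    ≡⟨ cong (λ s → h 1 0 + s + (h 0 0 + h 0 0)) (∑-cong (allFin k) (λ x → cong (h 0) (δ-suc b x))) ⟩
  h 1 0 + (∑[ x ∈ allFin k ] h 0 (δ b x)) + (h 0 0 + h 0 0)
    ≡⟨ regroup (h 1 0) _ (h 0 0) ⟩
  h 1 0 + ((∑[ x ∈ allFin k ] h 0 (δ b x)) + h 0 0) + h 0 0
    ≡⟨ cong (λ s → h 1 0 + s + h 0 0) (∑-allFin-δ b (h 0)) ⟩
  h 1 0 + (h 0 1 + k * h 0 0) + h 0 0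
    ≡⟨ collect (h 1 0) (h 0 1) k (h 0 0) ⟩
  h 1 0 + h 0 1 + suc k * h 0 0
    ∎
  where
  open ≡-Reasoning
  regroup : ∀ u s c → u + s + (c + c) ≡ u + (s + c) + c
  regroup = solve-∀
  collect : ∀ u v k c → u + (v + k * c) + c ≡ u + v + suc k * c
  collect = solve-∀
∑-allFin-δ₂ {suc k} {suc a} {zero}  a≢b h = begin
  (∑[ x ∈ allFin (suc k) ] h (δ (suc a) x) (δ zero x)) + (h 0 0 + h 0 0)
    ≡⟨ cong (_+ (h 0 0 + h 0 0)) (∑-allFin-suc k (λ x → h (δ (suc a) x) (δ zero x))) ⟩
  h 0 1 + (∑[ x ∈ allFin k ] h (δ (suc a) (suc x)) 0) + (h 0 0 + h 0 0)
    ≡⟨ cong (λ s → h 0 1 + s + (h 0 0 + h 0 0)) (∑-cong (allFin k) (λ x → cong (λ u → h u 0) (δ-suc a x))) ⟩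
  h 0 1 + (∑[ x ∈ allFin k ] h (δ a x) 0) + (h 0 0 + h 0 0)
    ≡⟨ regroup (h 0 1) _ (h 0 0) ⟩
  h 0 1 + ((∑[ x ∈ allFin k ] h (δ a x) 0) + h 0 0) + h 0 0
    ≡⟨ cong (λ s → h 0 1 + s + h 0 0) (∑-allFin-δ a (λ u → h u 0)) ⟩
  h 0 1 + (h 1 0 + k * h 0 0) + h 0 0
    ≡⟨ collect (h 0 1) (h 1 0) k (h 0 0) ⟩
  h 1 0 + h 0 1 + suc k * h 0 0
    ∎
  where
  open ≡-Reasoning
  regroup : ∀ u s c → u + s + (c + c) ≡ u + (s + c) + c
  regroup = solve-∀
  collect : ∀ u v k c → u + (v + k * c) + c ≡ v + u + suc k * c
  collect = solve-∀
∑-allFin-δ₂ {suc k} {suc a} {suc b} a≢b h = begin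
  (∑[ x ∈ allFin (suc k) ] h (δ (suc a) x) (δ (suc b) x)) + (h 0 0 + h 0 0)
    ≡⟨ cong (_+ (h 0 0 + h 0 0)) (∑-allFin-suc k (λ x → h (δ (suc a) x) (δ (suc b) x))) ⟩
  h 0 0 + (∑[ x ∈ allFin k ] h (δ (suc a) (suc x)) (δ (suc b) (suc x))) + (h 0 0 + h 0 0)
    ≡⟨ cong (λ s → h 0 0 + s + (h 0 0 + h 0 0)) (∑-cong (allFin k) (λ x → cong₂ h (δ-suc a x) (δ-suc b x))) ⟩
  h 0 0 + (∑[ x ∈ allFin k ] h (δ a x) (δ b x)) + (h 0 0 + h 0 0)
    ≡⟨ +-assoc (h 0 0) _ _ ⟩
  h 0 0 + ((∑[ x ∈ allFin k ] h (δ a x) (δ b x)) + (h 0 0 + h 0 0))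
    ≡⟨ cong (h 0 0 +_) (∑-allFin-δ₂ (λ a≡b → a≢b (cong suc a≡b)) h) ⟩
  h 0 0 + (h 1 0 + h 0 1 + k * h 0 0)
    ≡⟨ collect (h 1 0) (h 0 1) k (h 0 0) ⟩
  h 1 0 + h 0 1 + suc k * h 0 0
    ∎
  where
  open ≡-Reasoning
  collect : ∀ u v k c → c + (u + v + k * c) ≡ u + v + suc k * c
  collect = solve-∀

∑-allFin-δ-1 : ∀ {k} (b : Fin k) → ∑[ a ∈ allFin k ] δ a b ≡ 1
∑-allFin-δ-1 {k} b = begin
  ∑[ a ∈ allFin k ] δ a b          ≡⟨ ∑-cong (allFin k) (λ a → δ-sym a b) ⟩
  ∑[ a ∈ allFin k ] δ b a          ≡⟨ +-identityʳ _ ⟨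
  (∑[ a ∈ allFin k ] δ b a) + 0    ≡⟨ ∑-allFin-δ b (λ u → u) ⟩
  1 + k * 0                        ≡⟨ cong (1 +_) (*-zeroʳ k) ⟩
  1                                ∎
  where open ≡-Reasoning

∑-allFin-if-≤ : ∀ {k} (b : Fin k) X Y → ∑[ a ∈ allFin k ] (if ⌊ a ≟ᶠ b ⌋ then X else Y) ≤ X + k * Y
∑-allFin-if-≤ {k} b X Y = begin
  ∑[ a ∈ allFin k ] (if ⌊ a ≟ᶠ b ⌋ then X else Y)  ≤⟨ ∑-mono-≤ (allFin k) (λ a → if-≤ ⌊ a ≟ᶠ b ⌋) ⟩
  ∑[ a ∈ allFin k ] (δ a b * X + Y)               ≡⟨ ∑-distrib-+ (allFin k) _ _ ⟩
  (∑[ a ∈ allFin k ] δ a b * X) + (∑[ _ ∈ allFin k ] Y)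
    ≡⟨ cong₂ _+_ (trans (∑-*ʳ (allFin k) X (λ a → δ a b)) (cong (_* X) (∑-allFin-δ-1 b))) (∑-allFin-const k Y) ⟩
  1 * X + k * Y                                   ≡⟨ cong (_+ k * Y) (*-identityˡ X) ⟩
  X + k * Y                                       ∎
  where
  open ≤-Reasoning
  if-≤ : ∀ p → (if p then X else Y) ≤ 𝟙 p * X + Y
  if-≤ true  = ≤-trans (m≤m+n X Y) (≤-reflexive (cong (_+ Y) (sym (*-identityˡ X))))
  if-≤ false = ≤-refl

-- Vec's constructors are opened only in this module, away from the List-built variable lists of `solve`.
module Codes where

  open import Data.Vec using (Vec; []; _∷_)
  open import Data.Vec.Properties using (≡-dec)

  module _ {A : Set} (xs : List A) where

    ∑-allVecs-suc : ∀ m (f : Vec A (suc m) → ℕ) → ∑ (allVecs xs (suc m)) f ≡ ∑[ x ∈ xs ] ∑[ v ∈ allVecs xs m ] f (x ∷ v)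
    ∑-allVecs-suc m f = trans (∑-concatMap _ xs f) (∑-cong xs (λ x → ∑-map (x ∷_) (allVecs xs m) f))

    ∑-allVecs-1 : ∀ m → ∑[ _ ∈ allVecs xs m ] 1 ≡ length xs ^ m
    ∑-allVecs-1 zero    = refl
    ∑-allVecs-1 (suc m) = begin
      ∑[ _ ∈ allVecs xs (suc m) ] 1            ≡⟨ ∑-allVecs-suc m (λ _ → 1) ⟩
      ∑[ _ ∈ xs ] ∑[ _ ∈ allVecs xs m ] 1      ≡⟨ ∑-const xs _ ⟩
      length xs * (∑[ _ ∈ allVecs xs m ] 1)    ≡⟨ cong (length xs *_) (∑-allVecs-1 m) ⟩
      length xs ^ suc m                        ∎
      where open ≡-Reasoning

  ∑-allCodes-1 : ∀ k n → ∑[ _ ∈ allCodes k n ] 1 ≡ k ^ n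
  ∑-allCodes-1 k n = trans (∑-allVecs-1 (allFin k) n) (cong (_^ n) (length-tabulate (λ i → i)))

  length-allCodes : ∀ k n → length (allCodes k n) ≡ k ^ n
  length-allCodes k n = trans (sym (*-identityʳ _)) (trans (sym (∑-const (allCodes k n) 1)) (∑-allCodes-1 k n))

  _≢ᵇ_ : ∀ {k n} → Code k n → Code k n → Bool
  y ≢ᵇ z = not ⌊ ≡-dec _≟ᶠ_ y z ⌋

  ≢ᵇ-∷ : ∀ {k n} (a b : Fin k) (v w : Code k n) → (a ∷ v) ≢ᵇ (b ∷ w) ≡ not (⌊ a ≟ᶠ b ⌋ ∧ ⌊ ≡-dec _≟ᶠ_ v w ⌋)
  ≢ᵇ-∷ a b v w with a ≟ᶠ b | ≡-dec _≟ᶠ_ v w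
  ... | yes _ | yes _ = refl
  ... | yes _ | no  _ = refl
  ... | no  _ | yes _ = refl
  ... | no  _ | no  _ = refl

  failures-≤-all : ∀ k n m (z : Code k n) → failures k n m z ≤ k ^ (n * m)
  failures-≤-all k n m z = begin
    failures k n m z                              ≡⟨ length-filterᵇ _ Q ⟩
    ∑[ qs ∈ Q ] 𝟙 (not (determinesᵇ qs z))        ≤⟨ ∑-mono-≤ Q (λ qs → 𝟙≤1 _) ⟩
    ∑[ _ ∈ Q ] 1                                  ≡⟨ ∑-allVecs-1 (allCodes k n) m ⟩
    length (allCodes k n) ^ m                     ≡⟨ cong (_^ m) (length-allCodes k n) ⟩
    (k ^ n) ^ m                                   ≡⟨ ^-*-assoc k n m ⟩
    k ^ (n * m)                                   ∎
    where
    open ≤-Reasoning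
    Q = allVecs (allCodes k n) m

  -- The offsets c, c′ let the induction on n absorb the answers at the first position.
  shiftedAgreements : ∀ {k n} → ℕ → ℕ → Code k n → Code k n → ℕ
  shiftedAgreements {k} {n} c c′ y z = ∑[ x ∈ allCodes k n ] 𝟙 (c + eq y x ≡ᵇ c′ + eq z x)

  agreements : ∀ {k n} → Code k n → Code k n → ℕ
  agreements = shiftedAgreements 0 0

  ∑-allVecs-consistent : ∀ {k n} (V : List (Code k n)) (y z : Code k n) m →
    ∑[ qs ∈ allVecs V m ] 𝟙 (consistentᵇ qs z y) ≡ (∑[ q ∈ V ] 𝟙 (eq y q ≡ᵇ eq z q)) ^ m
  ∑-allVecs-consistent V y z zero    = refl
  ∑-allVecs-consistent V y z (suc m) = begin
    ∑[ qs ∈ allVecs V (suc m) ] 𝟙 (consistentᵇ qs z y)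
      ≡⟨ ∑-allVecs-suc V m _ ⟩
    ∑[ q ∈ V ] ∑[ qs ∈ allVecs V m ] 𝟙 (agree q ∧ consistentᵇ qs z y)
      ≡⟨ ∑-cong V (λ q → trans (∑-cong (allVecs V m) (λ qs → 𝟙-∧ (agree q) _)) (∑-*ˡ (allVecs V m) (𝟙 (agree q)) _)) ⟩
    ∑[ q ∈ V ] 𝟙 (agree q) * (∑[ qs ∈ allVecs V m ] 𝟙 (consistentᵇ qs z y))
      ≡⟨ ∑-*ʳ V _ (λ q → 𝟙 (agree q)) ⟩
    (∑[ q ∈ V ] 𝟙 (agree q)) * (∑[ qs ∈ allVecs V m ] 𝟙 (consistentᵇ qs z y))
      ≡⟨ cong ((∑[ q ∈ V ] 𝟙 (agree q)) *_) (∑-allVecs-consistent V y z m) ⟩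
    (∑[ q ∈ V ] 𝟙 (agree q)) ^ suc m
      ∎
    where
    open ≡-Reasoning
    agree : Code _ _ → Bool
    agree q = eq y q ≡ᵇ eq z q

  failures-≤-∑-agreements^ : ∀ k n m (z : Code k n) →
    failures k n m z ≤ ∑[ y ∈ allCodes k n ] 𝟙 (y ≢ᵇ z) * agreements y z ^ m
  failures-≤-∑-agreements^ k n m z = begin
    failures k n m z
      ≡⟨ length-filterᵇ _ Q ⟩
    ∑[ qs ∈ Q ] 𝟙 (not (determinesᵇ qs z))
      ≤⟨ ∑-mono-≤ Q (λ qs → 𝟙-not-all-≤ _ V) ⟩
    ∑[ qs ∈ Q ] ∑[ y ∈ V ] 𝟙 (not (not (consistentᵇ qs z y) ∨ ⌊ ≡-dec _≟ᶠ_ y z ⌋))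
      ≡⟨ ∑-cong Q (λ qs → ∑-cong V (λ y → 𝟙-consistent-≢ (consistentᵇ qs z y) _)) ⟩
    ∑[ qs ∈ Q ] ∑[ y ∈ V ] 𝟙 (consistentᵇ qs z y) * 𝟙 (y ≢ᵇ z)
      ≡⟨ ∑-comm Q V _ ⟩
    ∑[ y ∈ V ] ∑[ qs ∈ Q ] 𝟙 (consistentᵇ qs z y) * 𝟙 (y ≢ᵇ z)
      ≡⟨ ∑-cong V (λ y → trans (∑-*ʳ Q _ _) (trans (*-comm _ (𝟙 (y ≢ᵇ z)))
                                (cong (𝟙 (y ≢ᵇ z) *_) (∑-allVecs-consistent V y z m)))) ⟩
    ∑[ y ∈ V ] 𝟙 (y ≢ᵇ z) * agreements y z ^ m
      ∎
    where
    open ≤-Reasoning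
    V = allCodes k n
    Q = allVecs V m
    𝟙-consistent-≢ : ∀ c e → 𝟙 (not (not c ∨ e)) ≡ 𝟙 c * 𝟙 (not e)
    𝟙-consistent-≢ true  e = sym (+-identityʳ _)
    𝟙-consistent-≢ false e = refl

  hamming : ∀ {k n} → Code k n → Code k n → ℕ
  hamming []      []      = 0
  hamming (a ∷ y) (b ∷ z) = 𝟙 (not ⌊ a ≟ᶠ b ⌋) + hamming y z

  shiftedAgreements-shift : ∀ {k n} d c c′ (y z : Code k n) →
    shiftedAgreements (d + c) (d + c′) y z ≡ shiftedAgreements c c′ y z
  shiftedAgreements-shift zero    c c′ y z = refl
  shiftedAgreements-shift (suc d) c c′ y z = shiftedAgreements-shift d c c′ y z

  shiftedAgreements-∷ : ∀ {k n} (a b : Fin k) (y z : Code k n) c c′ →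
    shiftedAgreements c c′ (a ∷ y) (b ∷ z) ≡ ∑[ x ∈ allFin k ] shiftedAgreements (δ a x + c) (δ b x + c′) y z
  shiftedAgreements-∷ {k} {n} a b y z c c′ = trans (∑-allVecs-suc (allFin k) n _)
    (∑-cong (allFin k) (λ x → ∑-cong (allCodes k n) (λ v →
      cong₂ (λ u w → 𝟙 (u ≡ᵇ w)) (exchange c (δ a x) (eq y v)) (exchange c′ (δ b x) (eq z v)))))
    where
    exchange : ∀ c d e → c + (d + e) ≡ d + c + e
    exchange c d e = trans (sym (+-assoc c d e)) (cong (_+ e) (+-comm c d))

  shiftedAgreements-∷-same : ∀ {k n} (a : Fin k) (y z : Code k n) c c′ →
    shiftedAgreements c c′ (a ∷ y) (a ∷ z) ≡ k * shiftedAgreements c c′ y z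
  shiftedAgreements-∷-same {k} a y z c c′ =
    trans (shiftedAgreements-∷ a a y z c c′)
          (trans (∑-cong (allFin k) (λ x → shiftedAgreements-shift (δ a x) c c′ y z)) (∑-allFin-const k _))

  -- The answer differences +1, −1 and 0 are mutually exclusive.
  shiftedAgreements-disjoint : ∀ {k n} (y z : Code k n) c c′ →
    shiftedAgreements (suc c) c′ y z + shiftedAgreements c (suc c′) y z + shiftedAgreements c c′ y z ≤ k ^ n
  shiftedAgreements-disjoint {k} {n} y z c c′ = begin
    shiftedAgreements (suc c) c′ y z + shiftedAgreements c (suc c′) y z + shiftedAgreements c c′ y z
      ≡⟨ sym (trans (∑-distrib-+ V _ _) (cong (_+ shiftedAgreements c c′ y z) (∑-distrib-+ V _ _))) ⟩
    ∑[ x ∈ V ] (𝟙 (suc (c + eq y x) ≡ᵇ c′ + eq z x) + 𝟙 (c + eq y x ≡ᵇ suc (c′ + eq z x)) + 𝟙 (c + eq y x ≡ᵇ c′ + eq z x))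
      ≤⟨ ∑-mono-≤ V (λ x → exclusive (c + eq y x) (c′ + eq z x)) ⟩
    ∑[ _ ∈ V ] 1
      ≡⟨ ∑-allCodes-1 k n ⟩
    k ^ n
      ∎
    where
    open ≤-Reasoning
    V = allCodes k n
    exclusive : ∀ u v → 𝟙 (suc u ≡ᵇ v) + 𝟙 (u ≡ᵇ suc v) + 𝟙 (u ≡ᵇ v) ≤ 1
    exclusive zero    zero    = s≤s z≤n
    exclusive zero    (suc v) = subst (_≤ 1) (sym (trans (+-identityʳ _) (+-identityʳ _))) (𝟙≤1 (zero ≡ᵇ v))
    exclusive (suc u) zero    = subst (_≤ 1) (sym (+-identityʳ _)) (𝟙≤1 (u ≡ᵇ zero))
    exclusive (suc u) (suc v) = exclusive u v

  shiftedAgreements-∷-distinct : ∀ {k n} {a b : Fin k} → ¬ a ≡ b → (y z : Code k n) → ∀ c c′ →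
    let X = shiftedAgreements c c′ y z in
    shiftedAgreements c c′ (a ∷ y) (b ∷ z) + (X + X) ≡
    shiftedAgreements (suc c) c′ y z + shiftedAgreements c (suc c′) y z + k * X
  shiftedAgreements-∷-distinct {a = a} {b} a≢b y z c c′ =
    trans (cong (_+ _) (shiftedAgreements-∷ a b y z c c′))
          (∑-allFin-δ₂ a≢b (λ u v → shiftedAgreements (u + c) (v + c′) y z))

  shiftedAgreements-bound : ∀ {k} q → 2 ≤ k → 3 * q ≤ k → ∀ {n} (y z : Code k n) c c′ →
    k * shiftedAgreements c c′ y z + k ^ n * (hamming y z ⊓ q) ≤ k ^ n * k
  shiftedAgreements-bound {k} q 2≤k 3q≤k [] [] c c′ = begin
    k * (𝟙 (c + 0 ≡ᵇ c′ + 0) + 0) + 1 * 0  ≡⟨ cong (_+ 0) (cong (k *_) (+-identityʳ _)) ⟩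
    k * 𝟙 (c + 0 ≡ᵇ c′ + 0) + 0            ≤⟨ +-monoˡ-≤ 0 (*-monoʳ-≤ k (𝟙≤1 _)) ⟩
    k * 1 + 0                              ≡⟨ trans (+-identityʳ _) (trans (*-identityʳ k) (sym (*-identityˡ k))) ⟩
    1 * k                                  ∎
    where open ≤-Reasoning
  shiftedAgreements-bound {k} q 2≤k 3q≤k {suc n} (a ∷ y) (b ∷ z) c c′ = step (a ≟ᶠ b) c c′
    where
    open ≤-Reasoning
    P = k ^ n
    j = hamming y z
    G : ℕ → ℕ → ℕ
    G c c′ = shiftedAgreements c c′ y z
    bound-at : ∀ {i} → j ⊓ q ≡ i → ∀ c c′ → k * G c c′ + P * i ≤ P * k
    bound-at j⊓q≡i c c′ = subst (λ i → k * G c c′ + P * i ≤ P * k) j⊓q≡i (shiftedAgreements-bound q 2≤k 3q≤k y z c c′)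
    step : (d : Dec (a ≡ b)) → ∀ c c′ →
      k * shiftedAgreements c c′ (a ∷ y) (b ∷ z) + k * P * ((𝟙 (not ⌊ d ⌋) + j) ⊓ q) ≤ k * P * k
    step (yes refl) c c′ = begin
      k * shiftedAgreements c c′ (a ∷ y) (a ∷ z) + k * P * (j ⊓ q)  ≡⟨ cong (λ s → k * s + _) (shiftedAgreements-∷-same a y z c c′) ⟩
      k * (k * G c c′) + k * P * (j ⊓ q)                            ≡⟨ cong (k * (k * G c c′) +_) (*-assoc k P (j ⊓ q)) ⟩
      k * (k * G c c′) + k * (P * (j ⊓ q))                          ≡⟨ *-distribˡ-+ k _ _ ⟨
      k * (k * G c c′ + P * (j ⊓ q))                                ≤⟨ *-monoʳ-≤ k (bound-at refl c c′) ⟩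
      k * (P * k)                                                   ≡⟨ *-assoc k P k ⟨
      k * P * k                                                     ∎
    step (no a≢b) c c′ with suc j ≤? q
    ... | yes j<q rewrite m≤n⇒m⊓n≡m j<q =
      agreement-step-near {a = G (suc c) c′} {b = G c (suc c′)} (≤-trans (*-monoʳ-≤ 3 j<q) 3q≤k) (shiftedAgreements-∷-distinct a≢b y z c c′)
        (shiftedAgreements-disjoint y z c c′) (bound-at (m≤n⇒m⊓n≡m (≤-trans (n≤1+n j) j<q)) c c′)
    ... | no  j≮q rewrite m≥n⇒m⊓n≡n (<⇒≤ (≰⇒> j≮q)) =
      agreement-step-far {a = G (suc c) c′} {b = G c (suc c′)} 2≤k (shiftedAgreements-∷-distinct a≢b y z c c′)
        (bound-at q≤j (suc c) c′) (bound-at q≤j c (suc c′)) (bound-at q≤j c c′)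
      where
      q≤j : j ⊓ q ≡ q
      q≤j = m≥n⇒m⊓n≡n (s≤s⁻¹ (≰⇒> j≮q))

  weight : ∀ {k n} → ℕ → ℕ → Code k n → Code k n → ℕ
  weight T R []      []      = 1
  weight T R (a ∷ y) (b ∷ z) = (if ⌊ a ≟ᶠ b ⌋ then T else R) * weight T R y z

  weight-hamming : ∀ {k n} T R (y z : Code k n) → weight T R y z * T ^ hamming y z ≡ R ^ hamming y z * T ^ n
  weight-hamming T R []      []      = refl
  weight-hamming {n = suc n} T R (a ∷ y) (b ∷ z) with ⌊ a ≟ᶠ b ⌋
  ... | true  = begin
    T * w * T ^ j          ≡⟨ *-assoc T w _ ⟩
    T * (w * T ^ j)        ≡⟨ cong (T *_) (weight-hamming T R y z) ⟩
    T * (R ^ j * T ^ n)    ≡⟨ x∙yz≈y∙xz *-commutativeSemigroup T (R ^ j) _ ⟩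
    R ^ j * (T * T ^ n)    ∎
    where
    open ≡-Reasoning
    w = weight T R y z
    j = hamming y z
  ... | false = begin
    R * w * (T * T ^ j)          ≡⟨ *-assoc R w _ ⟩
    R * (w * (T * T ^ j))        ≡⟨ cong (R *_) (x∙yz≈y∙xz *-commutativeSemigroup w T _) ⟩
    R * (T * (w * T ^ j))        ≡⟨ cong (λ x → R * (T * x)) (weight-hamming T R y z) ⟩
    R * (T * (R ^ j * T ^ n))    ≡⟨ cong (R *_) (x∙yz≈y∙xz *-commutativeSemigroup T (R ^ j) _) ⟩
    R * (R ^ j * (T * T ^ n))    ≡⟨ *-assoc R (R ^ j) _ ⟨
    R * R ^ j * (T * T ^ n)      ∎
    where
    open ≡-Reasoning
    w = weight T R y z
    j = hamming y z

  ∑-weight-≤ : ∀ {k n} T R (z : Code k n) → ∑[ y ∈ allCodes k n ] weight T R y z ≤ (T + k * R) ^ n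
  ∑-weight-≤ T R [] = ≤-refl
  ∑-weight-≤ {k} {suc n} T R (b ∷ z) = begin
    ∑[ y ∈ allCodes k (suc n) ] weight T R y (b ∷ z)                      ≡⟨ ∑-allVecs-suc (allFin k) n _ ⟩
    ∑[ a ∈ allFin k ] ∑[ v ∈ allCodes k n ] choice a * weight T R v z   ≡⟨ ∑-cong (allFin k) (λ a → ∑-*ˡ (allCodes k n) (choice a) _) ⟩
    ∑[ a ∈ allFin k ] choice a * F                                      ≡⟨ ∑-*ʳ (allFin k) F choice ⟩
    (∑[ a ∈ allFin k ] choice a) * F                                    ≤⟨ *-mono-≤ (∑-allFin-if-≤ b T R) (∑-weight-≤ T R z) ⟩
    (T + k * R) * (T + k * R) ^ n                                       ∎
    where
    open ≤-Reasoning
    choice : Fin _ → ℕ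
    choice a = if ⌊ a ≟ᶠ b ⌋ then T else R
    F = ∑[ v ∈ allCodes k n ] weight T R v z

  ∑-weight-≢ : ∀ {k n} T R (z : Code k n) →
    (∑[ y ∈ allCodes k n ] 𝟙 (y ≢ᵇ z) * weight T R y z) * (T + k * R) ≤ n * (k * R) * (T + k * R) ^ n
  ∑-weight-≢ T R [] = z≤n
  ∑-weight-≢ {k} {suc n} T R (b ∷ z) = begin
    E′ * P                                          ≤⟨ *-monoˡ-≤ P E′≤ ⟩
    (T * E + k * (R * F)) * P                       ≡⟨ expand T E k R F P ⟩
    T * (E * P) + k * R * F * P                     ≤⟨ +-mono-≤ (*-mono-≤ (m≤m+n T (k * R)) (∑-weight-≢ T R z))
                                                                (*-monoˡ-≤ P (*-monoʳ-≤ (k * R) (∑-weight-≤ T R z))) ⟩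
    P * (n * (k * R) * P ^ n) + k * R * P ^ n * P   ≡⟨ collect P n (k * R) (P ^ n) ⟩
    suc n * (k * R) * (P * P ^ n)                   ∎
    where
    open ≤-Reasoning
    P = T + k * R
    V = allCodes k n
    E = ∑[ v ∈ V ] 𝟙 (v ≢ᵇ z) * weight T R v z
    F = ∑[ v ∈ V ] weight T R v z
    E′ = ∑[ y ∈ allCodes k (suc n) ] 𝟙 (y ≢ᵇ (b ∷ z)) * weight T R y (b ∷ z)
    column : ∀ a → ∑[ v ∈ V ] 𝟙 (not (⌊ a ≟ᶠ b ⌋ ∧ ⌊ ≡-dec _≟ᶠ_ v z ⌋)) * ((if ⌊ a ≟ᶠ b ⌋ then T else R) * weight T R v z)
                   ≡ (if ⌊ a ≟ᶠ b ⌋ then T * E else R * F)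
    column a with ⌊ a ≟ᶠ b ⌋
    ... | true  = trans (∑-cong V (λ v → x∙yz≈y∙xz *-commutativeSemigroup (𝟙 (v ≢ᵇ z)) T _)) (∑-*ˡ V T _)
    ... | false = trans (∑-cong V (λ v → *-identityˡ _)) (∑-*ˡ V R _)
    E′≤ : E′ ≤ T * E + k * (R * F)
    E′≤ = begin
      E′                                                        ≡⟨ ∑-allVecs-suc (allFin k) n _ ⟩
      ∑[ a ∈ allFin k ] ∑[ v ∈ V ] 𝟙 ((a ∷ v) ≢ᵇ (b ∷ z)) * weight T R (a ∷ v) (b ∷ z)
                                                                ≡⟨ ∑-cong (allFin k) (λ a → trans (∑-cong V (λ v → cong (λ e → 𝟙 e * weight T R (a ∷ v) (b ∷ z)) (≢ᵇ-∷ a b v z))) (column a)) ⟩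
      ∑[ a ∈ allFin k ] (if ⌊ a ≟ᶠ b ⌋ then T * E else R * F)   ≤⟨ ∑-allFin-if-≤ b (T * E) (R * F) ⟩
      T * E + k * (R * F)                                       ∎
    expand : ∀ T E k R F P → (T * E + k * (R * F)) * P ≡ T * (E * P) + k * R * F * P
    expand = solve-∀
    collect : ∀ P n x Pⁿ → P * (n * x * Pⁿ) + x * Pⁿ * P ≡ suc n * x * (P * Pⁿ)
    collect = solve-∀

open Codes

agreement-decay : ∀ {k n} m q (y z : Code k n) → 1 ≤ k →
  (k ∸ (hamming y z ⊓ q)) ^ m * (k ^ m) ^ n ≤ k ^ m * weight (k ^ m) ((k ∸ 1) ^ m) y z + (k ∸ q) ^ m * (k ^ m) ^ n
agreement-decay {k} {n} m q y z 1≤k with hamming y z ≤? q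
... | no  j≰q rewrite m≥n⇒m⊓n≡n (<⇒≤ (≰⇒> j≰q)) = m≤n+m _ _
... | yes j≤q rewrite m≤n⇒m⊓n≡m j≤q = ≤-trans (*-cancelʳ-≤ ((k ∸ j) ^ m * T ^ n) (T * W) (T ^ j) {{T^j≢0}} (begin
  (k ∸ j) ^ m * T ^ n * T ^ j    ≡⟨ rotate ((k ∸ j) ^ m) (T ^ n) (T ^ j) ⟩
  T ^ j * (k ∸ j) ^ m * T ^ n    ≤⟨ *-monoˡ-≤ (T ^ n) bernoulli-step ⟩
  T * R ^ j * T ^ n              ≡⟨ *-assoc T (R ^ j) (T ^ n) ⟩
  T * (R ^ j * T ^ n)            ≡⟨ cong (T *_) (weight-hamming T R y z) ⟨
  T * (W * T ^ j)                ≡⟨ *-assoc T W (T ^ j) ⟨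
  T * W * T ^ j                  ∎)) (m≤m+n _ _)
  where
  open ≤-Reasoning
  j = hamming y z
  T = k ^ m
  R = (k ∸ 1) ^ m
  W = weight T R y z
  T^j≢0 : NonZero (T ^ j)
  T^j≢0 = >-nonZero (1≤m^n T j (1≤m^n k m 1≤k))
  rotate : ∀ x y z → x * y * z ≡ z * x * y
  rotate = solve-∀
  ^-comm : ∀ a → (a ^ j) ^ m ≡ (a ^ m) ^ j
  ^-comm a = trans (^-*-assoc a j m) (trans (cong (a ^_) (*-comm j m)) (sym (^-*-assoc a m j)))
  bernoulli-step : T ^ j * (k ∸ j) ^ m ≤ T * R ^ j
  bernoulli-step = begin
    T ^ j * (k ∸ j) ^ m          ≡⟨ cong (_* (k ∸ j) ^ m) (^-comm k) ⟨
    (k ^ j) ^ m * (k ∸ j) ^ m    ≡⟨ ^-distribʳ-* (k ^ j) (k ∸ j) m ⟨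
    (k ^ j * (k ∸ j)) ^ m        ≤⟨ ^-monoˡ-≤ m (subst (λ x → k ^ j * (k ∸ x) ≤ k * (k ∸ 1) ^ j) (*-identityʳ j) (bernoulli-∸ k 1 j)) ⟩
    (k * (k ∸ 1) ^ j) ^ m        ≡⟨ ^-distribʳ-* k ((k ∸ 1) ^ j) m ⟩
    T * ((k ∸ 1) ^ j) ^ m        ≡⟨ cong (T *_) (^-comm (k ∸ 1)) ⟩
    T * R ^ j                    ∎

agreements^m-≤ : ∀ {k n} m q (y z : Code k n) → 2 ≤ k → 3 * q ≤ k →
  agreements y z ^ m * (k ^ m * (k ^ m) ^ n) ≤
  (k ^ n) ^ m * (k ^ m * weight (k ^ m) ((k ∸ 1) ^ m) y z + (k ∸ q) ^ m * (k ^ m) ^ n)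
agreements^m-≤ {k} {n} m q y z 2≤k 3q≤k = begin
  A ^ m * (T * T ^ n)              ≡⟨ x∙yz≈y∙xz *-commutativeSemigroup (A ^ m) T (T ^ n) ⟩
  T * (A ^ m * T ^ n)              ≡⟨ *-assoc T (A ^ m) (T ^ n) ⟨
  T * A ^ m * T ^ n                ≤⟨ *-monoˡ-≤ (T ^ n) kA^m≤ ⟩
  K ^ m * (k ∸ d) ^ m * T ^ n      ≡⟨ *-assoc (K ^ m) _ (T ^ n) ⟩
  K ^ m * ((k ∸ d) ^ m * T ^ n)    ≤⟨ *-monoʳ-≤ (K ^ m) (agreement-decay m q y z (≤-trans (s≤s z≤n) 2≤k)) ⟩
  K ^ m * (T * weight T ((k ∸ 1) ^ m) y z + (k ∸ q) ^ m * T ^ n) ∎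
  where
  open ≤-Reasoning
  A = agreements y z
  T = k ^ m
  K = k ^ n
  d = hamming y z ⊓ q
  kA≤ : k * A ≤ K * (k ∸ d)
  kA≤ = ≤-trans (m+n≤o⇒m≤o∸n (k * A) (shiftedAgreements-bound q 2≤k 3q≤k y z 0 0))
                (≤-reflexive (sym (*-distribˡ-∸ K k d)))
  kA^m≤ : T * A ^ m ≤ K ^ m * (k ∸ d) ^ m
  kA^m≤ = subst₂ _≤_ (^-distribʳ-* k A m) (^-distribʳ-* K (k ∸ d) m) (^-monoˡ-≤ m kA≤)

failures-bound : ∀ k n m q (z : Code k n) → 2 ≤ k → 3 * q ≤ k → 2 * (n * (k * (k ∸ 1) ^ m)) ≤ k ^ m →
  failures k n m z * k ^ m ≤ (k ^ n) ^ m * (2 * n * (k * (k ∸ 1) ^ m) + k ^ n * (k ∸ q) ^ m)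
failures-bound k n m q z 2≤k 3q≤k small =
  *-cancelʳ-≤ (failures k n m z * T) (K ^ m * (2 * n * (k * R) + K * Q)) (T ^ n) {{T^n≢0}} (begin
    failures k n m z * T * T ^ n
      ≤⟨ *-monoˡ-≤ (T ^ n) (*-monoˡ-≤ T (failures-≤-∑-agreements^ k n m z)) ⟩
    (∑[ y ∈ V ] ≢z y * agreements y z ^ m) * T * T ^ n
      ≡⟨ trans (*-assoc (∑[ y ∈ V ] ≢z y * agreements y z ^ m) T (T ^ n)) (sym (∑-*ʳ V (T * T ^ n) (λ y → ≢z y * agreements y z ^ m))) ⟩
    ∑[ y ∈ V ] ≢z y * agreements y z ^ m * (T * T ^ n)
      ≤⟨ ∑-mono-≤ V (λ y → ≤-trans (≤-reflexive (*-assoc (≢z y) _ _))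
                                    (*-monoʳ-≤ (≢z y) (agreements^m-≤ m q y z 2≤k 3q≤k))) ⟩
    ∑[ y ∈ V ] ≢z y * (K ^ m * (T * W y + Q * T ^ n))
      ≡⟨ ∑-cong V (λ y → spread (≢z y) (K ^ m) T (W y) Q (T ^ n)) ⟩
    ∑[ y ∈ V ] (K ^ m * T * (≢z y * W y) + K ^ m * (Q * T ^ n) * ≢z y)
      ≡⟨ ∑-distrib-+ V _ _ ⟩
    (∑[ y ∈ V ] K ^ m * T * (≢z y * W y)) + (∑[ y ∈ V ] K ^ m * (Q * T ^ n) * ≢z y)
      ≡⟨ cong₂ _+_ (∑-*ˡ V (K ^ m * T) _) (∑-*ˡ V (K ^ m * (Q * T ^ n)) ≢z) ⟩
    K ^ m * T * E + K ^ m * (Q * T ^ n) * (∑[ y ∈ V ] ≢z y)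
      ≤⟨ +-mono-≤ (≤-reflexive (*-assoc (K ^ m) T E)) (*-monoʳ-≤ (K ^ m * (Q * T ^ n)) #≢z≤K) ⟩
    K ^ m * (T * E) + K ^ m * (Q * T ^ n) * K
      ≤⟨ +-monoˡ-≤ _ (*-monoʳ-≤ (K ^ m) TE≤) ⟩
    K ^ m * (2 * n * (k * R) * T ^ n) + K ^ m * (Q * T ^ n) * K
      ≡⟨ gather (K ^ m) n (k * R) (T ^ n) Q K ⟩
    K ^ m * (2 * n * (k * R) + K * Q) * T ^ n
      ∎)
  where
  open ≤-Reasoning
  T = k ^ m
  R = (k ∸ 1) ^ m
  Q = (k ∸ q) ^ m
  K = k ^ n
  V = allCodes k n
  ≢z : Code k n → ℕ
  ≢z y = 𝟙 (y ≢ᵇ z)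
  W : Code k n → ℕ
  W y = weight T R y z
  E = ∑[ y ∈ V ] ≢z y * W y
  1≤T : 1 ≤ T
  1≤T = 1≤m^n k m (≤-trans (s≤s z≤n) 2≤k)
  T^n≢0 : NonZero (T ^ n)
  T^n≢0 = >-nonZero (1≤m^n T n 1≤T)
  #≢z≤K : ∑[ y ∈ V ] ≢z y ≤ K
  #≢z≤K = ≤-trans (∑-mono-≤ V (λ y → 𝟙≤1 _)) (≤-reflexive (∑-allCodes-1 k n))
  TE≤ : T * E ≤ 2 * n * (k * R) * T ^ n
  TE≤ = begin
    T * E                                ≡⟨ *-comm T E ⟩
    E * T                                ≤⟨ *-monoʳ-≤ E (m≤m+n T (k * R)) ⟩
    E * (T + k * R)                      ≤⟨ ∑-weight-≢ T R z ⟩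
    n * (k * R) * (T + k * R) ^ n        ≤⟨ *-monoʳ-≤ (n * (k * R)) ([m+n]^k≤2*m^k T (k * R) n 1≤T small) ⟩
    n * (k * R) * (2 * T ^ n)            ≡⟨ x∙yz≈y∙xz *-commutativeSemigroup (n * (k * R)) 2 (T ^ n) ⟩
    2 * (n * (k * R) * T ^ n)            ≡⟨ trans (cong (_* T ^ n) (*-assoc 2 n (k * R))) (*-assoc 2 (n * (k * R)) (T ^ n)) ⟨
    2 * n * (k * R) * T ^ n              ∎
  spread : ∀ x a b c d e → x * (a * (b * c + d * e)) ≡ a * b * (x * c) + a * (d * e) * x
  spread = solve-∀
  gather : ∀ a n x t q K → a * (2 * n * x * t) + a * (q * t) * K ≡ a * (2 * n * x + K * q) * t
  gather = solve-∀

failures-tail : ∀ {k n q M} (z : Code k n) → 2 ≤ k → 3 * q ≤ k →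
  4 * n * k * (k ∸ 1) ^ M ≤ k ^ M → 2 * k ^ n * (k ∸ q) ^ M ≤ k ^ M →
  ∀ i → failures k n (M + i) z * (2 * k ^ i) ≤ (k ^ n) ^ (M + i) * ((k ∸ 1) ^ i + (k ∸ q) ^ i)
failures-tail {k} {n} {q} {M} z 2≤k 3q≤k R₀-small Q₀-small i =
  *-cancelʳ-≤ (F * (2 * k ^ i)) (KT * (A + B)) (k ^ M) {{k^M≢0}} (begin
    F * (2 * k ^ i) * k ^ M                                    ≡⟨ pull-2 F (k ^ i) (k ^ M) ⟩
    2 * (F * (k ^ M * k ^ i))                                  ≡⟨ cong (λ x → 2 * (F * x)) (^-distribˡ-+-* k M i) ⟨
    2 * (F * k ^ (M + i))                                      ≤⟨ *-monoʳ-≤ 2 (failures-bound k n (M + i) q z 2≤k 3q≤k small) ⟩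
    2 * (KT * (2 * n * (k * (k ∸ 1) ^ (M + i)) + K * (k ∸ q) ^ (M + i)))
      ≡⟨ cong₂ (λ x y → 2 * (KT * (2 * n * (k * x) + K * y))) (^-distribˡ-+-* (k ∸ 1) M i) (^-distribˡ-+-* (k ∸ q) M i) ⟩
    2 * (KT * (2 * n * (k * (R₀ * A)) + K * (Q₀ * B)))          ≡⟨ expand KT n k R₀ A K Q₀ B ⟩
    KT * (4 * n * k * R₀ * A + 2 * K * Q₀ * B)                  ≤⟨ *-monoʳ-≤ KT (+-mono-≤ (*-monoˡ-≤ A R₀-small) (*-monoˡ-≤ B Q₀-small)) ⟩
    KT * (k ^ M * A + k ^ M * B)                                ≡⟨ collect KT (k ^ M) A B ⟩
    KT * (A + B) * k ^ M                                        ∎)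
  where
  open ≤-Reasoning
  F = failures k n (M + i) z
  K = k ^ n
  KT = K ^ (M + i)
  R₀ = (k ∸ 1) ^ M
  Q₀ = (k ∸ q) ^ M
  A = (k ∸ 1) ^ i
  B = (k ∸ q) ^ i
  k^M≢0 : NonZero (k ^ M)
  k^M≢0 = >-nonZero (1≤m^n k M (≤-trans (s≤s z≤n) 2≤k))
  double : ∀ n k R₀ A → 2 * (n * (k * (R₀ * A))) * 2 ≡ 4 * n * k * R₀ * A
  double = solve-∀
  small : 2 * (n * (k * (k ∸ 1) ^ (M + i))) ≤ k ^ (M + i)
  small = begin
    2 * (n * (k * (k ∸ 1) ^ (M + i)))  ≡⟨ cong (λ x → 2 * (n * (k * x))) (^-distribˡ-+-* (k ∸ 1) M i) ⟩
    2 * (n * (k * (R₀ * A)))           ≤⟨ m≤m*n _ 2 ⟩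
    2 * (n * (k * (R₀ * A))) * 2       ≡⟨ double n k R₀ A ⟩
    4 * n * k * R₀ * A                 ≤⟨ *-monoˡ-≤ A R₀-small ⟩
    k ^ M * A                          ≤⟨ *-monoʳ-≤ (k ^ M) (^-monoˡ-≤ i (m∸n≤m k 1)) ⟩
    k ^ M * k ^ i                      ≡⟨ ^-distribˡ-+-* k M i ⟨
    k ^ (M + i)                        ∎
  pull-2 : ∀ F x y → F * (2 * x) * y ≡ 2 * (F * (y * x))
  pull-2 = solve-∀
  expand : ∀ KT n k R₀ A K Q₀ B → 2 * (KT * (2 * n * (k * (R₀ * A)) + K * (Q₀ * B))) ≡ KT * (4 * n * k * R₀ * A + 2 * K * Q₀ * B)
  expand = solve-∀
  collect : ∀ KT x A B → KT * (x * A + x * B) ≡ KT * (A + B) * x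
  collect = solve-∀

failures-decay : ∀ {k n q M} (z : Code k n) → 2 ≤ k → 3 * q ≤ k → 1 ≤ q →
  4 * n * k * (k ∸ 1) ^ M ≤ k ^ M → 2 * k ^ n * (k ∸ q) ^ M ≤ k ^ M →
  ∀ t m → M + t * k ≤ m → failures k n m z * 2 ^ t ≤ (k ^ n) ^ m
failures-decay {k} {n} {q} {M} z 2≤k 3q≤k 1≤q R₀-small Q₀-small t m M+tk≤m
  with i , refl ← m≤n⇒∃[o]m+o≡n (≤-trans (m≤m+n M (t * k)) M+tk≤m) =
  *-cancelʳ-≤ (F * 2 ^ t) KT (2 * k ^ i) {{2k^i≢0}} (begin
    F * 2 ^ t * (2 * k ^ i)          ≡⟨ xy∙z≈xz∙y *-commutativeSemigroup F (2 ^ t) _ ⟩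
    F * (2 * k ^ i) * 2 ^ t          ≤⟨ *-monoˡ-≤ (2 ^ t) (failures-tail {q = q} {M = M} z 2≤k 3q≤k R₀-small Q₀-small i) ⟩
    KT * (A + (k ∸ q) ^ i) * 2 ^ t   ≤⟨ *-monoˡ-≤ (2 ^ t) (*-monoʳ-≤ KT (+-monoʳ-≤ A B≤A)) ⟩
    KT * (A + A) * 2 ^ t             ≡⟨ regroup KT A (2 ^ t) ⟩
    KT * (2 * (A * 2 ^ t))           ≤⟨ *-monoʳ-≤ KT (*-monoʳ-≤ 2 (^-halving ([k∸1]^k*2≤k^k k 2≤k) (m∸n≤m k 1) t i tk≤i)) ⟩
    KT * (2 * k ^ i)                 ∎)
  where
  open ≤-Reasoning
  F = failures k n (M + i) z
  KT = (k ^ n) ^ (M + i)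
  A = (k ∸ 1) ^ i
  B≤A : (k ∸ q) ^ i ≤ A
  B≤A = ^-monoˡ-≤ i (∸-monoʳ-≤ k 1≤q)
  tk≤i : t * k ≤ i
  tk≤i = +-cancelˡ-≤ M _ _ M+tk≤m
  2k^i≢0 : NonZero (2 * k ^ i)
  2k^i≢0 = >-nonZero (*-mono-≤ (s≤s (z≤n {1})) (1≤m^n k i (≤-trans (s≤s z≤n) 2≤k)))
  regroup : ∀ KT A x → KT * (A + A) * x ≡ KT * (2 * (A * x))
  regroup = solve-∀

-- Integer `+_` is opened only in this module: elsewhere it makes sections such as `m +_` ambiguous.
module Fractions where

  open import Data.Integer using (+_; +≤+)

  toℚᵘ-frac : ∀ a b → toℚᵘ (frac a (suc b)) ≃ mkℚᵘ (+ a) b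
  toℚᵘ-frac a b = ℚ.toℚᵘ-fromℚᵘ (mkℚᵘ (+ a) b)

  frac-≤ : ∀ {a b c d} → 1 ≤ b → 1 ≤ d → a * d ≤ c * b → frac a b ≤ℚ frac c d
  frac-≤ {a} {suc b} {c} {suc d} _ _ ad≤cb = ℚ.toℚᵘ-cancel-≤ (begin
    toℚᵘ (frac a (suc b))  ≃⟨ toℚᵘ-frac a b ⟩
    mkℚᵘ (+ a) b           ≤⟨ *≤* (subst₂ ℤ._≤_ (ℤ.pos-* a (suc d)) (ℤ.pos-* c (suc b)) (+≤+ ad≤cb)) ⟩
    mkℚᵘ (+ c) d           ≃⟨ toℚᵘ-frac c d ⟨
    toℚᵘ (frac c (suc d))  ∎)
    where open ℚᵘ.≤-Reasoning

  pos-[*+*]* : ∀ a d c b f → + ((a * d + c * b) * f) ≡ (+ a ℤ.* + d ℤ.+ + c ℤ.* + b) ℤ.* + f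
  pos-[*+*]* a d c b f = begin
    + ((a * d + c * b) * f)                ≡⟨ ℤ.pos-* (a * d + c * b) f ⟩
    + (a * d + c * b) ℤ.* + f              ≡⟨ cong (ℤ._* + f) (ℤ.pos-+ (a * d) (c * b)) ⟩
    (+ (a * d) ℤ.+ + (c * b)) ℤ.* + f      ≡⟨ cong₂ (λ x y → (x ℤ.+ y) ℤ.* + f) (ℤ.pos-* a d) (ℤ.pos-* c b) ⟩
    (+ a ℤ.* + d ℤ.+ + c ℤ.* + b) ℤ.* + f  ∎
    where open ≡-Reasoning

  frac+frac-≤ : ∀ {a b c d e f} → 1 ≤ b → 1 ≤ d → 1 ≤ f →
    (a * d + c * b) * f ≤ e * (b * d) → frac a b +ℚ frac c d ≤ℚ frac e f
  frac+frac-≤ {a} {suc b} {c} {suc d} {e} {suc f} _ _ _ h = ℚ.toℚᵘ-cancel-≤ (begin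
    toℚᵘ (frac a (suc b) +ℚ frac c (suc d))           ≃⟨ ℚ.toℚᵘ-homo-+ (frac a (suc b)) (frac c (suc d)) ⟩
    toℚᵘ (frac a (suc b)) +ᵘ toℚᵘ (frac c (suc d))  ≃⟨ ℚᵘ.+-cong (toℚᵘ-frac a b) (toℚᵘ-frac c d) ⟩
    mkℚᵘ (+ a) b +ᵘ mkℚᵘ (+ c) d                    ≤⟨ *≤* (subst₂ ℤ._≤_ (pos-[*+*]* a (suc d) c (suc b) (suc f)) (ℤ.pos-* e (suc b * suc d)) (+≤+ h)) ⟩
    mkℚᵘ (+ e) f                                      ≃⟨ toℚᵘ-frac e f ⟨
    toℚᵘ (frac e (suc f))                             ∎)
    where
    open ℚᵘ.≤-Reasoning

open Fractions

0≤frac : ∀ a {b} → 1 ≤ b → 0ℚ ≤ℚ frac a b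
0≤frac a {b} 1≤b = frac-≤ {0} {1} {a} {b} (s≤s z≤n) 1≤b z≤n

p≤p+q : ∀ {p q} → 0ℚ ≤ℚ q → p ≤ℚ p +ℚ q
p≤p+q {p} 0≤q = ℚ.≤-trans (ℚ.≤-reflexive (sym (ℚ.+-identityʳ p))) (ℚ.+-monoʳ-≤ p 0≤q)

partialSum : (ℕ → ℚ) → ℕ → ℚ
partialSum p zero    = 0ℚ
partialSum p (suc M) = partialSum p M +ℚ p M

expPartial≡partialSum : ∀ k n M (z : Code k n) → expPartial k n M z ≡ partialSum (λ m → probFail k n m z) M
expPartial≡partialSum k n zero    z = refl
expPartial≡partialSum k n (suc M) z = cong (_+ℚ probFail k n M z) (expPartial≡partialSum k n M z)

partialSum-≤ : ∀ (p : ℕ → ℚ) → (∀ m → p m ≤ℚ 1ℚ) → ∀ M → partialSum p M ≤ℚ frac M 1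
partialSum-≤ p p≤1 zero    = ℚ.≤-refl
partialSum-≤ p p≤1 (suc M) =
  ℚ.≤-trans (ℚ.+-mono-≤ (partialSum-≤ p p≤1 M) (p≤1 M))
            (frac+frac-≤ {M} {1} {1} {1} {suc M} {1} (s≤s z≤n) (s≤s z≤n) (s≤s z≤n) (≤-reflexive (solve (M ∷ []))))

partialSum-telescope : ∀ (p Ψ : ℕ → ℚ) M₀ → (∀ m → p m ≤ℚ 1ℚ) → (∀ i → 0ℚ ≤ℚ Ψ i) →
  (∀ i → p (M₀ + i) +ℚ Ψ (suc i) ≤ℚ Ψ i) → ∀ M → partialSum p M ≤ℚ frac M₀ 1 +ℚ Ψ 0
partialSum-telescope p Ψ M₀ p≤1 0≤Ψ step M with M ≤? M₀
... | yes M≤M₀ = begin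
  partialSum p M         ≤⟨ partialSum-≤ p p≤1 M ⟩
  frac M 1               ≤⟨ frac-≤ {M} {1} {M₀} {1} (s≤s z≤n) (s≤s z≤n) (*-monoˡ-≤ 1 M≤M₀) ⟩
  frac M₀ 1              ≤⟨ p≤p+q (0≤Ψ 0) ⟩
  frac M₀ 1 +ℚ Ψ 0       ∎
  where open ℚ.≤-Reasoning
... | no  M≰M₀ with i , refl ← m≤n⇒∃[o]m+o≡n (<⇒≤ (≰⇒> M≰M₀)) = ℚ.≤-trans (p≤p+q (0≤Ψ i)) (shifted i)
  where
  shifted : ∀ i → partialSum p (M₀ + i) +ℚ Ψ i ≤ℚ frac M₀ 1 +ℚ Ψ 0
  shifted zero    rewrite +-identityʳ M₀ = ℚ.+-monoˡ-≤ (Ψ 0) (partialSum-≤ p p≤1 M₀)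
  shifted (suc i) rewrite +-suc M₀ i = begin
    partialSum p (M₀ + i) +ℚ p (M₀ + i) +ℚ Ψ (suc i)    ≡⟨ ℚ.+-assoc (partialSum p (M₀ + i)) _ _ ⟩
    partialSum p (M₀ + i) +ℚ (p (M₀ + i) +ℚ Ψ (suc i))  ≤⟨ ℚ.+-monoʳ-≤ (partialSum p (M₀ + i)) (step i) ⟩
    partialSum p (M₀ + i) +ℚ Ψ i                        ≤⟨ shifted i ⟩
    frac M₀ 1 +ℚ Ψ 0                                    ∎
    where open ℚ.≤-Reasoning

-- Σ_{j ≥ i} ((1 − 1/k)^j + (1 − q/k)^j) / 2  =  (k (1 − 1/k)^i + (k/q) (1 − q/k)^i) / 2
geometricTail : ℕ → ℕ → ℕ → ℚ
geometricTail k q i = frac (q * k * (k ∸ 1) ^ i + k * (k ∸ q) ^ i) (2 * q * k ^ i)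

probFail≤1 : ∀ k n m (z : Code k n) → 1 ≤ k → probFail k n m z ≤ℚ 1ℚ
probFail≤1 k n m z 1≤k = frac-≤ {failures k n m z} {k ^ (n * m)} {1} {1} (1≤m^n k (n * m) 1≤k) (s≤s z≤n)
  (≤-trans (≤-reflexive (*-identityʳ _)) (≤-trans (failures-≤-all k n m z) (≤-reflexive (sym (*-identityˡ _)))))

0≤geometricTail : ∀ {k q} → 1 ≤ k → 1 ≤ q → ∀ i → 0ℚ ≤ℚ geometricTail k q i
0≤geometricTail {k} 1≤k 1≤q i = 0≤frac _ (*-mono-≤ (*-mono-≤ (s≤s (z≤n {1})) 1≤q) (1≤m^n k i 1≤k))

probFail+geometricTail-≤ : ∀ {k n q M} (z : Code k n) → 2 ≤ k → 3 * q ≤ k → 1 ≤ q → q < k →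
  4 * n * k * (k ∸ 1) ^ M ≤ k ^ M → 2 * k ^ n * (k ∸ q) ^ M ≤ k ^ M →
  ∀ i → probFail k n (M + i) z +ℚ geometricTail k q (suc i) ≤ℚ geometricTail k q i
probFail+geometricTail-≤ {k} {n} {q} {M} z 2≤k 3q≤k 1≤q q<k R₀-small Q₀-small i =
  frac+frac-≤ {F} {KT} {N (suc i)} {D (suc i)} {N i} {D i} (1≤m^n k (n * (M + i)) 1≤k) (1≤D (suc i)) (1≤D i) (begin
    (F * D (suc i) + N (suc i) * KT) * D i
      ≡⟨ expand F q k (k ^ i) (N (suc i)) KT (D i) ⟩
    q * k * (F * (2 * k ^ i)) * D i + N (suc i) * KT * D i
      ≤⟨ +-monoˡ-≤ _ (*-monoˡ-≤ (D i) (*-monoʳ-≤ (q * k) tail)) ⟩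
    q * k * (KT * (A + B)) * D i + N (suc i) * KT * D i
      ≡⟨ collect q k KT (A + B) (N (suc i)) (D i) ⟩
    (N (suc i) + q * k * (A + B)) * KT * D i
      ≡⟨ cong (λ x → x * KT * D i) N-step ⟨
    N i * k * KT * D i
      ≡⟨ shift (N i) k KT q (k ^ i) ⟩
    N i * (KT * D (suc i))
      ∎)
  where
  open ≤-Reasoning
  1≤k = ≤-trans (s≤s z≤n) 2≤k
  F = failures k n (M + i) z
  KT = k ^ (n * (M + i))
  A = (k ∸ 1) ^ i
  B = (k ∸ q) ^ i
  N : ℕ → ℕ
  N j = q * k * (k ∸ 1) ^ j + k * (k ∸ q) ^ j
  D : ℕ → ℕ
  D j = 2 * q * k ^ j
  1≤D : ∀ j → 1 ≤ D j
  1≤D j = *-mono-≤ (*-mono-≤ (s≤s (z≤n {1})) 1≤q) (1≤m^n k j 1≤k)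
  tail : F * (2 * k ^ i) ≤ KT * (A + B)
  tail = subst (λ x → F * (2 * k ^ i) ≤ x * (A + B)) (^-*-assoc k n (M + i))
               (failures-tail {q = q} {M = M} z 2≤k 3q≤k R₀-small Q₀-small i)
  split : ∀ q k A B a b → q * k * A * (a + 1) + k * B * (b + q) ≡ q * k * (a * A) + k * (b * B) + q * k * (A + B)
  split = solve-∀
  N-step : N i * k ≡ N (suc i) + q * k * (A + B)
  N-step = begin-equality
    (q * k * A + k * B) * k                    ≡⟨ *-distribʳ-+ k (q * k * A) (k * B) ⟩
    q * k * A * k + k * B * k                  ≡⟨ cong₂ (λ x y → q * k * A * x + k * B * y) (m∸n+n≡m 1≤k) (m∸n+n≡m (<⇒≤ q<k)) ⟨
    q * k * A * (k ∸ 1 + 1) + k * B * (k ∸ q + q) ≡⟨ split q k A B (k ∸ 1) (k ∸ q) ⟩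
    N (suc i) + q * k * (A + B)                ∎
  expand : ∀ F q k x N KT D → (F * (2 * q * (k * x)) + N * KT) * D ≡ q * k * (F * (2 * x)) * D + N * KT * D
  expand = solve-∀
  collect : ∀ q k KT S N D → q * k * (KT * S) * D + N * KT * D ≡ (N + q * k * S) * KT * D
  collect = solve-∀
  shift : ∀ N k KT q x → N * k * KT * (2 * q * x) ≡ N * (KT * (2 * q * (k * x)))
  shift = solve-∀

n<2^[1+⌊log2⌋n] : ∀ n (rec : Acc _<_ n) → n < 2 ^ suc (⌊log2⌋ n rec)
n<2^[1+⌊log2⌋n] zero          _        = s≤s z≤n
n<2^[1+⌊log2⌋n] (suc zero)    _        = s≤s (s≤s z≤n)
n<2^[1+⌊log2⌋n] (suc (suc n)) (acc rs) = begin-strict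
  2 + n                      ≤⟨ s≤s (s≤s (n≤1+⌊n/2⌋+⌊n/2⌋ n)) ⟩
  3 + (⌊ n /2⌋ + ⌊ n /2⌋)    <⟨ n<1+n _ ⟩
  4 + (⌊ n /2⌋ + ⌊ n /2⌋)    ≡⟨ double ⌊ n /2⌋ ⟩
  2 * (2 + ⌊ n /2⌋)          ≤⟨ *-monoʳ-≤ 2 (n<2^[1+⌊log2⌋n] (suc ⌊ n /2⌋) (rs (⌊n/2⌋<n (suc n)))) ⟩
  2 * 2 ^ suc (⌊log2⌋ (suc ⌊ n /2⌋) (rs (⌊n/2⌋<n (suc n)))) ∎
  where
  open ≤-Reasoning
  double : ∀ h → 4 + (h + h) ≡ 2 * (2 + h)
  double h = solve (h ∷ [])
  n≤1+⌊n/2⌋+⌊n/2⌋ : ∀ n → n ≤ suc (⌊ n /2⌋ + ⌊ n /2⌋)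
  n≤1+⌊n/2⌋+⌊n/2⌋ zero          = z≤n
  n≤1+⌊n/2⌋+⌊n/2⌋ (suc zero)    = s≤s z≤n
  n≤1+⌊n/2⌋+⌊n/2⌋ (suc (suc n)) =
    s≤s (≤-trans (s≤s (n≤1+⌊n/2⌋+⌊n/2⌋ n)) (s≤s (≤-reflexive (sym (+-suc ⌊ n /2⌋ ⌊ n /2⌋)))))

n≤2^[1+⌊log₂n⌋] : ∀ n → n ≤ 2 ^ suc ⌊log₂ n ⌋
n≤2^[1+⌊log₂n⌋] n = <⇒≤ (n<2^[1+⌊log2⌋n] n (<-wellFounded n))

2^m≤n⇒m≤⌊log₂n⌋ : ∀ {m n} → 2 ^ m ≤ n → m ≤ ⌊log₂ n ⌋
2^m≤n⇒m≤⌊log₂n⌋ {m} {n} 2^m≤n = subst (_≤ ⌊log₂ n ⌋) (⌊log₂[2^n]⌋≡n m) (⌊log₂⌋-mono-≤ 2^m≤n)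

4nk≤2^[2+a+b] : ∀ {n k a b} → n ≤ 2 ^ a → k ≤ 2 ^ b → 4 * n * k ≤ 2 ^ (2 + a + b)
4nk≤2^[2+a+b] {n} {k} {a} {b} n≤2^a k≤2^b = begin
  4 * n * k              ≤⟨ *-mono-≤ (*-monoʳ-≤ 4 n≤2^a) k≤2^b ⟩
  2 ^ 2 * 2 ^ a * 2 ^ b  ≡⟨ cong (_* 2 ^ b) (^-distribˡ-+-* 2 2 a) ⟨
  2 ^ (2 + a) * 2 ^ b    ≡⟨ ^-distribˡ-+-* 2 (2 + a) b ⟨
  2 ^ (2 + a + b)        ∎
  where open ≤-Reasoning

2k^n≤2^[1+b*n] : ∀ {k b} n → k ≤ 2 ^ b → 2 * k ^ n ≤ 2 ^ (1 + b * n)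
2k^n≤2^[1+b*n] {k} {b} n k≤2^b = *-monoʳ-≤ 2 (≤-trans (^-monoˡ-≤ n k≤2^b) (≤-reflexive (^-*-assoc 2 b n)))

3≤k : ∀ {d s n k} → 2 ^ (5 + d + s) ≤ n → n ≤ d * k → 3 ≤ k
3≤k {d} {s} {n} {k} N≤n n≤dk with 3 ≤? k
... | yes 3≤k = 3≤k
... | no  3≰k = contradiction N≤n (<⇒≱ (begin-strict
  n                ≤⟨ n≤dk ⟩
  d * k            ≤⟨ *-monoʳ-≤ d (s≤s⁻¹ (≰⇒> 3≰k)) ⟩
  d * 2            ≡⟨ *-comm d 2 ⟩
  2 * d            <⟨ *-monoʳ-< 2 (m<2^m d) ⟩
  2 ^ suc d        ≤⟨ ^-monoʳ-≤ 2 (s≤s (≤-trans (m≤n+m d 4) (m≤m+n (4 + d) s))) ⟩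
  2 ^ (5 + d + s)  ∎))
  where open ≤-Reasoning

-- With t₁ = 2 + (L+1) + (d + L+1) ≥ log₂ (4 n k) and t₂ = 1 + (d + L+1) n ≥ log₂ (2 k^n), the M = t₁ k + 6 t₂
-- queries that make both error terms ≤ 1/2, plus s k queries for s further halvings, fit into (3 d + 11) n L.
query-budget : ∀ d s n k L → 1 ≤ n → k ≤ d * n → 5 + d + s ≤ L →
  (2 + suc L + (d + suc L)) * k + (1 + (d + suc L) * n) * 6 + s * k ≤ (3 * d + 11) * n * L
query-budget d s (suc n₁) k L _ k≤dn 5+d+s≤L with w , refl ← m≤n⇒∃[o]m+o≡n 5+d+s≤L =
  let n = suc n₁
      t₁ = 2 + suc L + (d + suc L)
      t₂ = 1 + (d + suc L) * n
      slack = 13 + d * n₁ * w + d * w + 19 * n₁ + 5 * n₁ * s + 5 * n₁ * w + 5 * s + 5 * w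
  in begin
  t₁ * k + t₂ * 6 + s * k                      ≤⟨ +-mono-≤ (+-monoˡ-≤ (t₂ * 6) (*-monoʳ-≤ t₁ k≤dn)) (*-monoʳ-≤ s k≤dn) ⟩
  t₁ * (d * n) + t₂ * 6 + s * (d * n)          ≤⟨ m≤m+n _ slack ⟩
  t₁ * (d * n) + t₂ * 6 + s * (d * n) + slack  ≡⟨ solve (d ∷ s ∷ n₁ ∷ w ∷ []) ⟩
  (3 * d + 11) * n * L                         ∎
  where open ≤-Reasoning

-- The geometric tail starts at (q k + k) / (2 q) ≤ k.
geometricTail-0-fits : ∀ M q k X → 1 ≤ q → M + 1 * k ≤ X →
  (M * (2 * q * 1) + (q * k * 1 + k * 1) * 1) * 1 ≤ X * (1 * (2 * q * 1))
geometricTail-0-fits M q k X 1≤q M+k≤X = begin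
  (M * (2 * q * 1) + (q * k * 1 + k * 1) * 1) * 1  ≡⟨ solve (M ∷ q ∷ k ∷ []) ⟩
  2 * q * M + q * k + k                            ≤⟨ +-monoʳ-≤ (2 * q * M + q * k) (≤-trans (≤-reflexive (sym (*-identityˡ k))) (*-monoˡ-≤ k 1≤q)) ⟩
  2 * q * M + q * k + q * k                        ≡⟨ solve (M ∷ q ∷ k ∷ []) ⟩
  2 * q * (M + 1 * k)                              ≤⟨ *-monoʳ-≤ (2 * q) M+k≤X ⟩
  2 * q * X                                        ≡⟨ solve (q ∷ X ∷ []) ⟩
  X * (1 * (2 * q * 1))                            ∎
  where open ≤-Reasoning

-- The parameters q = ⌊k/3⌋ and M of the tail bounds, for n ≥ 2^(5 + d + s) and n ≤ d k ≤ d² n.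
record Regime (d s n k : ℕ) : Set where
  field
    q M      : ℕ
    2≤k      : 2 ≤ k
    3q≤k     : 3 * q ≤ k
    1≤q      : 1 ≤ q
    q<k      : q < k
    R₀-small : 4 * n * k * (k ∸ 1) ^ M ≤ k ^ M
    Q₀-small : 2 * k ^ n * (k ∸ q) ^ M ≤ k ^ M
    budget   : M + s * k ≤ (3 * d + 11) * n * ⌊log₂ n ⌋

regime : ∀ d s n k → 2 ^ (5 + d + s) ≤ n → n ≤ d * k → k ≤ d * n → Regime d s n k
regime d s n k N≤n n≤dk k≤dn = record
  { q        = q
  ; M        = t₁ * k + t₂ * 6
  ; 2≤k      = 2≤k′
  ; 3q≤k     = 3*[k/3]≤k k
  ; 1≤q      = 1≤q
  ; q<k      = q<k
  ; R₀-small = *-^-halving {k ∸ 1} {k} {k} {4 * n * k} {t₁} (t₁ * k + t₂ * 6)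
                 ([k∸1]^k*2≤k^k k 2≤k′) (m∸n≤m k 1)
                 (4nk≤2^[2+a+b] {n} {k} {suc L} {d + suc L} (n≤2^[1+⌊log₂n⌋] n) k≤2^[d+1+L])
                 (m≤m+n (t₁ * k) (t₂ * 6))
  ; Q₀-small = *-^-halving {k ∸ q} {k} {6} {2 * k ^ n} {t₂} (t₁ * k + t₂ * 6)
                 ([k∸q]^6*2≤k^6 k q q<k (k≤7*[k/3] 3≤k′)) (m∸n≤m k q)
                 (2k^n≤2^[1+b*n] {k} {d + suc L} n k≤2^[d+1+L])
                 (m≤n+m (t₂ * 6) (t₁ * k))
  ; budget   = query-budget d s n k L (≤-trans (m^n>0 2 (5 + d + s)) N≤n) k≤dn (2^m≤n⇒m≤⌊log₂n⌋ N≤n)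
  }
  where
  L = ⌊log₂ n ⌋
  q = k / 3
  t₁ = 2 + suc L + (d + suc L)
  t₂ = 1 + (d + suc L) * n
  3≤k′ : 3 ≤ k
  3≤k′ = 3≤k {d} {s} N≤n n≤dk
  2≤k′ : 2 ≤ k
  2≤k′ = ≤-trans (n≤1+n 2) 3≤k′
  1≤q : 1 ≤ q
  1≤q = 1≤k/3 3≤k′
  q<k : q < k
  q<k = 3q≤k⇒q<k 1≤q (3*[k/3]≤k k)
  k≤2^[d+1+L] : k ≤ 2 ^ (d + suc L)
  k≤2^[d+1+L] = ≤-trans k≤dn (≤-trans (*-mono-≤ (<⇒≤ (m<2^m d)) (n≤2^[1+⌊log₂n⌋] n))
                                       (≤-reflexive (sym (^-distribˡ-+-* 2 d (suc L)))))

expPartial-≤-nlogn : ∀ d n k → 2 ^ (5 + d + 1) ≤ n → n ≤ d * k → k ≤ d * n → (z : Code k n) → ∀ M′ →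
  expPartial k n M′ z ≤ℚ ℕtoℚ (nlogn (3 * d + 11) n)
expPartial-≤-nlogn d n k N≤n n≤dk k≤dn z M′ = ℚ.≤-trans
  (subst (_≤ℚ frac M 1 +ℚ geometricTail k q 0) (sym (expPartial≡partialSum k n M′ z))
         (partialSum-telescope (λ m → probFail k n m z) (geometricTail k q) M (λ m → probFail≤1 k n m z 1≤k)
                               (0≤geometricTail 1≤k 1≤q) (probFail+geometricTail-≤ z 2≤k 3q≤k 1≤q q<k R₀-small Q₀-small) M′))
  (frac+frac-≤ {M} {1} {q * k * 1 + k * 1} {2 * q * 1} {(3 * d + 11) * n * ⌊log₂ n ⌋} {1}
               (s≤s z≤n) (*-mono-≤ (*-mono-≤ (s≤s (z≤n {1})) 1≤q) (s≤s z≤n)) (s≤s z≤n)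
               (geometricTail-0-fits M q k _ 1≤q budget))
  where
  open Regime (regime d 1 n k N≤n n≤dk k≤dn)
  1≤k : 1 ≤ k
  1≤k = ≤-trans (n≤1+n 1) 2≤k

failures*s-≤ : ∀ d s n k C → 2 ^ (5 + d + s) ≤ n → n ≤ d * k → k ≤ d * n → 3 * d + 11 ≤ C → (z : Code k n) →
  failures k n (nlogn C n) z * s ≤ k ^ (n * nlogn C n)
failures*s-≤ d s n k C N≤n n≤dk k≤dn 3d+11≤C z = begin
  failures k n m z * s      ≤⟨ *-monoʳ-≤ (failures k n m z) (<⇒≤ (m<2^m s)) ⟩
  failures k n m z * 2 ^ s  ≤⟨ failures-decay z 2≤k 3q≤k 1≤q R₀-small Q₀-small s m
                                 (≤-trans budget (*-monoˡ-≤ ⌊log₂ n ⌋ (*-monoˡ-≤ n 3d+11≤C))) ⟩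
  (k ^ n) ^ m               ≡⟨ ^-*-assoc k n m ⟩
  k ^ (n * m)               ∎
  where
  open ≤-Reasoning
  open Regime (regime d s n k N≤n n≤dk k≤dn)
  m = nlogn C n

probFail-≤ : ∀ d C → 3 * d + 11 ≤ C → (ε : ℚ) → 0ℚ <ℚ ε →
  Σ ℕ λ N → (n k : ℕ) → N ≤ n → n ≤ d * k → k ≤ d * n → (z : Code k n) → probFail k n (nlogn C n) z ≤ℚ ε
probFail-≤ d C 3d+11≤C ε@(mkℚ ℤ.+[1+ p ] s-1 _) _ = 2 ^ (5 + d + suc s-1) , λ n k N≤n n≤dk k≤dn z →
  subst (probFail k n (nlogn C n) z ≤ℚ_) (ℚ.↥p/↧p≡p ε)
    (frac-≤ {failures k n (nlogn C n) z} {k ^ (n * nlogn C n)} {suc p} {suc s-1}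
            (1≤m^n k (n * nlogn C n) (≤-trans (s≤s z≤n) (3≤k {d} {suc s-1} N≤n n≤dk))) (s≤s z≤n)
            (≤-trans (failures*s-≤ d (suc s-1) n k C N≤n n≤dk k≤dn 3d+11≤C z) (m≤n*m _ (suc p))))
probFail-≤ d C _ (mkℚ (ℤ.+ zero)   _ _) 0<0 with positive 0<0
... | ()
probFail-≤ d C _ (mkℚ ℤ.-[1+ _ ] _ _) 0<ε with positive 0<ε
... | ()

lemma12 : (d : ℕ) → 1 ≤ d →
    (Σ ℕ λ C → Σ ℕ λ N → (n k : ℕ) → N ≤ n → n ≤ d * k → k ≤ d * n →
    (z : Code k n) → (M : ℕ) → expPartial k n M z ≤ℚ ℕtoℚ (nlogn C n))
    ×
    (Σ ℕ λ C₀ → (C : ℕ) → C₀ ≤ C → (ε : ℚ) → 0ℚ <ℚ ε →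
    Σ ℕ λ N → (n k : ℕ) → N ≤ n → n ≤ d * k → k ≤ d * n →
    (z : Code k n) → probFail k n (nlogn C n) z ≤ℚ ε)
lemma12 d _ = (3 * d + 11 , 2 ^ (5 + d + 1) , expPartial-≤-nlogn d) , (3 * d + 11 , probFail-≤ d)
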